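{- Let $n$ be a positive integer and let $S\subseteq\mathbb{Z}/n\mathbb{Z}$ with $0\in S$ be a quasi-progression with difference $r$. Suppose that $S$ generates $\mathbb{Z}/n\mathbb{Z}$ and $|S|\ge 3$. Let $T\subseteq\mathbb{Z}/n\mathbb{Z}$ with $|T|\ge 3$ and $|S+T|\le|S|+|T|\le n-4$. Then one of the following holds: (i) $T$ is either a quasi-progression with difference $r$ or an arithmetic progression with difference $r$; (ii) $n=12$ and $T$ is a coset of a subgroup of order $4$.
   Context: An arithmetic progression with difference $r$ is a set $\{a,a+r,\dots,a+(\ell-1)r\}$ of $\ell$ distinct elements. A set $S$ is a quasi-progression of difference $r$ if $S$ is not an arithmetic progression with difference $r$ and $S$ can be obtained by deleting one element from an arithmetic progression of difference $r$. -}

module Defs where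

open import Data.Nat using (ℕ; zero; suc; _+_; _*_; _∸_; NonZero)
open import Data.Nat.DivMod using (_mod_)
open import Data.Fin using (Fin; toℕ; _≟_)
open import Data.Fin.Properties using (any?)
open import Data.Fin.Subset using (Subset; _∈_; _∉_; ∣_∣)
open import Data.Fin.Subset.Properties using (_∈?_)
open import Data.Vec using (tabulate)
open import Data.Product using (Σ; ∃; _×_; _,_)
open import Relation.Nullary using (¬_; does)
open import Relation.Nullary.Decidable using (_×-dec_)
open import Relation.Binary.PropositionalEquality using (_≡_; _≢_)

-- Z/nZ is modelled as Fin n (n positive), with arithmetic mod n.
module _ (n : ℕ) .{{_ : NonZero n}} where

  infixl 6 _⊕_
  _⊕_ : Fin n → Fin n → Fin n
  x ⊕ y = (toℕ x + toℕ y) mod n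

  ⊖_ : Fin n → Fin n
  ⊖ x = (n ∸ toℕ x) mod n

  0ₙ : Fin n
  0ₙ = 0 mod n

  _·_ : ℕ → Fin n → Fin n
  k · x = (k * toℕ x) mod n

  sumset : Subset n → Subset n → Subset n
  sumset S T = tabulate λ x →
    does (any? λ s → any? λ t → (s ∈? S) ×-dec ((t ∈? T) ×-dec ((s ⊕ t) ≟ x)))

  IsAP : Fin n → Subset n → Set
  IsAP r S = Σ (Fin n) λ a → Σ ℕ λ ℓ →
      (∀ (i j : Fin ℓ) → a ⊕ (toℕ i · r) ≡ a ⊕ (toℕ j · r) → i ≡ j)
    × (∀ x → (x ∈ S → ∃ λ (i : Fin ℓ) → x ≡ a ⊕ (toℕ i · r))
           × ((∃ λ (i : Fin ℓ) → x ≡ a ⊕ (toℕ i · r)) → x ∈ S))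

  IsQuasiProgression : Fin n → Subset n → Set
  IsQuasiProgression r S = ¬ IsAP r S ×
    Σ (Subset n) λ P → IsAP r P × Σ (Fin n) λ z → z ∈ P ×
      (∀ x → (x ∈ S → x ∈ P × x ≢ z) × (x ∈ P × x ≢ z → x ∈ S))

  data Gen (S : Subset n) : Fin n → Set where
    gen-elem : ∀ {x} → x ∈ S → Gen S x
    gen-zero : Gen S 0ₙ
    gen-add  : ∀ {x y} → Gen S x → Gen S y → Gen S (x ⊕ y)
    gen-neg  : ∀ {x} → Gen S x → Gen S (⊖ x)

  Generates : Subset n → Set
  Generates S = ∀ x → Gen S x

  IsSubgroup : Subset n → Set
  IsSubgroup H = (0ₙ ∈ H) × (∀ x y → x ∈ H → y ∈ H → (x ⊕ y) ∈ H) × (∀ x → x ∈ H → (⊖ x) ∈ H)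

  IsCosetOfSubgroupOfOrder : ℕ → Subset n → Set
  IsCosetOfSubgroupOfOrder k T = Σ (Subset n) λ H → IsSubgroup H × ∣ H ∣ ≡ k ×
    Σ (Fin n) λ g → ∀ x → (x ∈ T → ∃ λ h → h ∈ H × x ≡ g ⊕ h)
                        × ((∃ λ h → h ∈ H × x ≡ g ⊕ h) → x ∈ T)

module Submission where

-- Since 0 ∈ S and S generates ℤ/n, the difference r is a unit, and in the coordinates
-- u ↦ a + u r the set S becomes {0, …, K} ∖ {J} with 0 < J < K = |S|.  Write ρ for T in
-- these coordinates and D = {1, …, K} ∖ {J}; then |S + T| ≤ |S| + |T| says that at most K
-- points of ρ + D, the bad points, lie outside ρ.  Call t ∈ ρ isolated if no other point of ρ
-- lies in [t − (K − J), t + J].  A hole whose nearest predecessor in ρ is at distance at most K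
-- is bad or lies J after an isolated point.
--
-- If ρ has a gap of length K, rotate so that ρ ⊆ [0, L] with 0, L ∈ ρ.  The K − 1 points L + D
-- are bad, leaving room for at most one more, and comparing the holes of [0, L] with the
-- isolated points and their neighbours leaves at most one hole: T is a progression or a
-- quasi-progression.  Otherwise every hole is bad or follows an isolated point, so with s
-- isolated points and G ≥ K + 4 holes, G ≤ K + s while J s ≤ G and (K − J) s ≤ G.  This
-- forces J = K − J = 2, s = 4, G = 8; then every point of ρ is isolated, n = 12, and ρ is a
-- coset of 3ℤ/12ℤ.

open import Defs
open import Data.Bool using (Bool; true; false; _∧_; _∨_; not)
open import Data.Bool.Properties using (∧-identityʳ; ∨-zeroʳ; ∨-inverseʳ; ∧-conicalˡ; ∧-conicalʳ)
open import Data.Empty using (⊥; ⊥-elim)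
open import Data.Fin using (Fin; toℕ; fromℕ<) renaming (zero to fzero; suc to fsuc; _≟_ to _≟ᶠ_)
open import Data.Fin.Properties using (toℕ-fromℕ<; toℕ-injective; toℕ<n; any?; all?)
open import Data.Fin.Subset using (Subset; _∈_; ∣_∣; _∪_; ⁅_⁆)
open import Data.Fin.Subset.Properties using (_∈?_; x∈p∪q⁻; x∈p∪q⁺; x∈⁅x⁆; x∈⁅y⁆⇒x≡y)
open import Data.Nat
open import Data.Nat.DivMod
open import Data.Nat.Divisibility using (_∣_; divides)
open import Data.Nat.Properties
open import Data.Nat.Tactic.RingSolver using (solve-∀)
open import Data.Product using (Σ; ∃; ∃₂; _×_; _,_; proj₁; proj₂)
open import Data.Sum using (_⊎_; inj₁; inj₂)
open import Data.Vec using (Vec; []; _∷_; lookup; tabulate)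
open import Data.Vec.Properties using (lookup⇒[]=; []=⇒lookup; lookup∘tabulate)
open import Function using (_∘_)
open import Level using (0ℓ)
open import Relation.Binary.Bundles using (Setoid)
import Relation.Binary.Reasoning.Setoid as SetoidReasoning
open import Relation.Binary.PropositionalEquality hiding (J)
open import Relation.Nullary using (Dec; yes; no; does)
open import Relation.Nullary.Decidable using (dec-true; dec-false; _×-dec_; _→-dec_)

module Booleans where

  true≢false : ∀ {b} → b ≡ true → b ≡ false → ⊥
  true≢false refl ()

  separates : ∀ {A : Set} (f : A → Bool) {x y} → f x ≡ true → f y ≡ false → x ≢ y
  separates f fx fy refl = true≢false fx fy

  ⇔⇒≡ : ∀ {a b} → (a ≡ true → b ≡ true) → (b ≡ true → a ≡ true) → a ≡ b
  ⇔⇒≡ {true}  a⇒b _   = sym (a⇒b refl)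
  ⇔⇒≡ {false} {true} _ b⇒a = b⇒a refl
  ⇔⇒≡ {false} {false} _ _  = refl

  ¬false⇒true : ∀ {b} → (b ≡ false → ⊥) → b ≡ true
  ¬false⇒true {true}  _  = refl
  ¬false⇒true {false} ¬f = ⊥-elim (¬f refl)

  ¬true⇒false : ∀ {b} → (b ≡ true → ⊥) → b ≡ false
  ¬true⇒false {false} _  = refl
  ¬true⇒false {true}  ¬t = ⊥-elim (¬t refl)

  ∨-elim : ∀ a b → a ∨ b ≡ true → a ≡ true ⊎ b ≡ true
  ∨-elim true  b _   = inj₁ refl
  ∨-elim false b a∨b = inj₂ a∨b

  ∨-introʳ : ∀ a {b} → b ≡ true → a ∨ b ≡ true
  ∨-introʳ a refl = ∨-zeroʳ a

  not-true : ∀ {a} → not a ≡ true → a ≡ false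
  not-true {false} _ = refl

  not-false : ∀ {a} → a ≡ false → not a ≡ true
  not-false refl = refl

open Booleans

<∧≢-1⇒< : ∀ {x m} → x < m → x ≢ m ∸ 1 → x < m ∸ 1
<∧≢-1⇒< {m = suc m} x<1+m x≢m = ≤∧≢⇒< (s≤s⁻¹ x<1+m) x≢m

0<m≤o∸n⇒m+n≤o : ∀ {m} n {o} → 0 < m → m ≤ o ∸ n → m + n ≤ o
0<m≤o∸n⇒m+n≤o {m} n {o} 0<m m≤o∸n with n ≤? o
... | yes n≤o = m≤o∸n⇒m+n≤o m n≤o m≤o∸n
... | no  n≰o = ⊥-elim (<⇒≱ 0<m (≤-trans m≤o∸n (≤-reflexive (m≤n⇒m∸n≡0 (<⇒≤ (≰⇒> n≰o))))))

module Counting where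

  indicator : Bool → ℕ
  indicator true  = 1
  indicator false = 0

  indicator≤1 : ∀ b → indicator b ≤ 1
  indicator≤1 true  = ≤-refl
  indicator≤1 false = z≤n

  count : ℕ → (ℕ → Bool) → ℕ
  count zero    f = 0
  count (suc N) f = indicator (f 0) + count N (λ u → f (suc u))

  _except_ : (ℕ → Bool) → ℕ → (ℕ → Bool)
  (f except v) u = f u ∧ not (does (u ≟ v))

  count-cong : ∀ N {f g : ℕ → Bool} → (∀ u → u < N → f u ≡ g u) → count N f ≡ count N g
  count-cong zero    f≗g = refl
  count-cong (suc N) f≗g =
    cong₂ _+_ (cong indicator (f≗g 0 z<s)) (count-cong N (λ u u<N → f≗g (suc u) (s<s u<N)))

  count-mono : ∀ N {f g : ℕ → Bool} → (∀ u → u < N → f u ≡ true → g u ≡ true) →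
               count N f ≤ count N g
  count-mono zero    f⇒g = z≤n
  count-mono (suc N) {f} {g} f⇒g =
    +-mono-≤ (indicator-mono (f 0) (g 0) (f⇒g 0 z<s)) (count-mono N (λ u u<N → f⇒g (suc u) (s<s u<N)))
    where
    indicator-mono : ∀ a b → (a ≡ true → b ≡ true) → indicator a ≤ indicator b
    indicator-mono false b _   = z≤n
    indicator-mono true  b a⇒b rewrite a⇒b refl = ≤-refl

  count-split : ∀ A B (f : ℕ → Bool) → count (A + B) f ≡ count A f + count B (λ u → f (A + u))
  count-split zero    B f = refl
  count-split (suc A) B f = begin
    indicator (f 0) + count (A + B) (λ u → f (suc u))
      ≡⟨ cong (indicator (f 0) +_) (count-split A B (λ u → f (suc u))) ⟩
    indicator (f 0) + (count A (λ u → f (suc u)) + count B (λ u → f (suc A + u)))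
      ≡⟨ +-assoc (indicator (f 0)) _ _ ⟨
    count (suc A) f + count B (λ u → f (suc A + u)) ∎
    where open ≡-Reasoning

  count-suc : ∀ N (f : ℕ → Bool) → count (suc N) f ≡ count N f + indicator (f N)
  count-suc N f = begin
    count (suc N) f                                ≡⟨ cong (λ m → count m f) (+-comm 1 N) ⟩
    count (N + 1) f                                ≡⟨ count-split N 1 f ⟩
    count N f + (indicator (f (N + 0)) + 0)        ≡⟨ cong (count N f +_) (+-identityʳ _) ⟩
    count N f + indicator (f (N + 0))              ≡⟨ cong (λ m → count N f + indicator (f m)) (+-identityʳ N) ⟩
    count N f + indicator (f N)                    ∎
    where open ≡-Reasoning

  count-true : ∀ N → count N (λ _ → true) ≡ N
  count-true zero    = refl
  count-true (suc N) = cong suc (count-true N)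

  count-false : ∀ N {f : ℕ → Bool} → (∀ u → u < N → f u ≡ false) → count N f ≡ 0
  count-false zero    f≗false = refl
  count-false (suc N) f≗false rewrite f≗false 0 z<s =
    count-false N (λ u u<N → f≗false (suc u) (s<s u<N))

  count-∨+count-∧ : ∀ N (f g : ℕ → Bool) →
    count N (λ u → f u ∨ g u) + count N (λ u → f u ∧ g u) ≡ count N f + count N g
  count-∨+count-∧ zero    f g = refl
  count-∨+count-∧ (suc N) f g = begin
    (indicator (f 0 ∨ g 0) + X) + (indicator (f 0 ∧ g 0) + Y)
      ≡⟨ interchange (indicator (f 0 ∨ g 0)) X (indicator (f 0 ∧ g 0)) Y ⟩
    (indicator (f 0 ∨ g 0) + indicator (f 0 ∧ g 0)) + (X + Y)
      ≡⟨ cong₂ _+_ (head (f 0) (g 0)) (count-∨+count-∧ N (λ u → f (suc u)) (λ u → g (suc u))) ⟩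
    (indicator (f 0) + indicator (g 0)) + (count N (λ u → f (suc u)) + count N (λ u → g (suc u)))
      ≡⟨ interchange (indicator (f 0)) (indicator (g 0)) _ _ ⟩
    count (suc N) f + count (suc N) g ∎
    where
    open ≡-Reasoning
    X = count N (λ u → f (suc u) ∨ g (suc u))
    Y = count N (λ u → f (suc u) ∧ g (suc u))
    interchange : ∀ a b c d → (a + b) + (c + d) ≡ (a + c) + (b + d)
    interchange = solve-∀
    head : ∀ a b → indicator (a ∨ b) + indicator (a ∧ b) ≡ indicator a + indicator b
    head true  true  = refl
    head true  false = refl
    head false true  = refl
    head false false = refl

  count-∨-disjoint : ∀ N (f g : ℕ → Bool) → (∀ u → u < N → f u ≡ true → g u ≡ true → ⊥) →
    count N (λ u → f u ∨ g u) ≡ count N f + count N g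
  count-∨-disjoint N f g disjoint = begin
    count N (λ u → f u ∨ g u)                                   ≡⟨ +-identityʳ _ ⟨
    count N (λ u → f u ∨ g u) + 0                               ≡⟨ cong (count N (λ u → f u ∨ g u) +_) (count-false N (λ u u<N → no-overlap (f u) (g u) (disjoint u u<N))) ⟨
    count N (λ u → f u ∨ g u) + count N (λ u → f u ∧ g u)       ≡⟨ count-∨+count-∧ N f g ⟩
    count N f + count N g                                       ∎
    where
    open ≡-Reasoning
    no-overlap : ∀ a b → (a ≡ true → b ≡ true → ⊥) → a ∧ b ≡ false
    no-overlap true  true  both = ⊥-elim (both refl refl)
    no-overlap true  false _    = refl
    no-overlap false b     _    = refl

  count-∨-≤ : ∀ N (f g : ℕ → Bool) → count N (λ u → f u ∨ g u) ≤ count N f + count N g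
  count-∨-≤ N f g = subst (count N (λ u → f u ∨ g u) ≤_) (count-∨+count-∧ N f g) (m≤m+n _ _)

  count-except : ∀ N v (f : ℕ → Bool) → v < N → f v ≡ true → suc (count N (f except v)) ≡ count N f
  count-except (suc N) zero    f _         f0 rewrite f0 =
    cong suc (count-cong N (λ u _ → ∧-identityʳ (f (suc u))))
  count-except (suc N) (suc v) f (s<s v<N) fv =
    trans (sym (+-suc (indicator (f 0 ∧ true)) _))
          (cong₂ _+_ (cong indicator (∧-identityʳ (f 0))) (count-except N v (λ u → f (suc u)) v<N fv))

  count-injection : ∀ N M (f g : ℕ → Bool) (h : ℕ → ℕ) →
    (∀ u → u < N → f u ≡ true → h u < M × g (h u) ≡ true) →
    (∀ u v → u < N → v < N → f u ≡ true → f v ≡ true → h u ≡ h v → u ≡ v) →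
    count N f ≤ count M g
  count-injection zero    M f g h maps inj = z≤n
  count-injection (suc N) M f g h maps inj with f 0 in f0
  ... | false = count-injection N M (λ u → f (suc u)) g (λ u → h (suc u))
                  (λ u u<N → maps (suc u) (s<s u<N))
                  (λ u v u<N v<N fu fv e → suc-injective (inj (suc u) (suc v) (s<s u<N) (s<s v<N) fu fv e))
  ... | true  with maps 0 z<s f0
  ...   | h0<M , gh0 = subst (suc (count N (λ u → f (suc u))) ≤_) (count-except M (h 0) g h0<M gh0)
                         (s≤s (count-injection N M (λ u → f (suc u)) (g except h 0) (λ u → h (suc u))
                                 maps-tail
                                 (λ u v u<N v<N fu fv e → suc-injective (inj (suc u) (suc v) (s<s u<N) (s<s v<N) fu fv e))))
    where
    maps-tail : ∀ u → u < N → f (suc u) ≡ true → h (suc u) < M × (g except h 0) (h (suc u)) ≡ true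
    maps-tail u u<N fu with maps (suc u) (s<s u<N) fu
    ... | hu<M , ghu rewrite ghu
        | dec-false (h (suc u) ≟ h 0) (λ e → 0≢1+n (sym (inj (suc u) 0 (s<s u<N) z<s fu f0 e))) = hu<M , refl

  except-true : ∀ (f : ℕ → Bool) {u v} → f u ≡ true → u ≢ v → (f except v) u ≡ true
  except-true f {u} {v} fu u≢v rewrite fu | dec-false (u ≟ v) u≢v = refl

  except-elim : ∀ (f : ℕ → Bool) {u v} → (f except v) u ≡ true → f u ≡ true × u ≢ v
  except-elim f {u} fu∧u≢v = ∧-conicalˡ _ _ fu∧u≢v ,
    λ { refl → true≢false (∧-conicalʳ _ _ fu∧u≢v) (cong not (dec-true (u ≟ u) refl)) }

  count-< : ∀ N (f g : ℕ → Bool) v → v < N → (∀ u → u < N → f u ≡ true → g u ≡ true) →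
            g v ≡ true → f v ≡ false → count N f < count N g
  count-< N f g v v<N f⇒g gv fv = subst (count N f <_) (count-except N v g v<N gv)
    (s≤s (count-mono N (λ u u<N fu → except-true g (f⇒g u u<N fu) (λ { refl → true≢false fu fv }))))

  count-≥1 : ∀ N (f : ℕ → Bool) a → a < N → f a ≡ true → 1 ≤ count N f
  count-≥1 N f a a<N fa = subst (1 ≤_) (count-except N a f a<N fa) (s≤s z≤n)

  count-≥2 : ∀ N (f : ℕ → Bool) a b → a < N → b < N → a ≢ b → f a ≡ true → f b ≡ true → 2 ≤ count N f
  count-≥2 N f a b a<N b<N a≢b fa fb = subst (2 ≤_) (count-except N b f b<N fb)
    (s≤s (count-≥1 N (f except b) a a<N (except-true f fa a≢b)))

  count-≥3 : ∀ N (f : ℕ → Bool) a b c → a < N → b < N → c < N → a ≢ b → a ≢ c → b ≢ c →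
             f a ≡ true → f b ≡ true → f c ≡ true → 3 ≤ count N f
  count-≥3 N f a b c a<N b<N c<N a≢b a≢c b≢c fa fb fc = subst (3 ≤_) (count-except N c f c<N fc)
    (s≤s (count-≥2 N (f except c) a b a<N b<N a≢b (except-true f fa a≢c) (except-true f fb b≢c)))

  count-witness : ∀ N (f : ℕ → Bool) → 1 ≤ count N f → ∃ λ u → u < N × f u ≡ true
  count-witness (suc N) f 1≤c with f 0 in f0
  ... | true  = 0 , z<s , f0
  ... | false with count-witness N (λ u → f (suc u)) 1≤c
  ...   | u , u<N , fu = suc u , s<s u<N , fu

  count-window : ∀ A M N (f : ℕ → Bool) → A + M ≤ N → count A f + count M (λ u → f (A + u)) ≤ count N f
  count-window A M N f A+M≤N = begin
    count A f + count M (λ u → f (A + u))                   ≡⟨ count-split A M f ⟨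
    count (A + M) f                                         ≤⟨ m≤m+n _ _ ⟩
    count (A + M) f + count (N ∸ (A + M)) (λ u → f (A + M + u)) ≡⟨ count-split (A + M) (N ∸ (A + M)) f ⟨
    count (A + M + (N ∸ (A + M))) f                         ≡⟨ cong (λ m → count m f) (m+[n∸m]≡n A+M≤N) ⟩
    count N f                                               ∎
    where open ≤-Reasoning

open Counting

module BoundedSearch where

  anyBelow : ℕ → (ℕ → Bool) → Bool
  anyBelow zero    p = false
  anyBelow (suc m) p = anyBelow m p ∨ p m

  anyBelow-intro : ∀ m p e → e < m → p e ≡ true → anyBelow m p ≡ true
  anyBelow-intro (suc m) p e e<1+m pe with m≤n⇒m<n∨m≡n (s≤s⁻¹ e<1+m)
  ... | inj₁ e<m  = cong (_∨ p m) (anyBelow-intro m p e e<m pe)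
  ... | inj₂ refl = ∨-introʳ (anyBelow m p) pe

  anyBelow-elim : ∀ m p → anyBelow m p ≡ true → ∃ λ e → e < m × p e ≡ true
  anyBelow-elim (suc m) p any with ∨-elim (anyBelow m p) (p m) any
  ... | inj₁ any′ with anyBelow-elim m p any′
  ...   | e , e<m , pe = e , m<n⇒m<1+n e<m , pe
  anyBelow-elim (suc m) p any | inj₂ pm = m , ≤-refl , pm

  anyBelow-false : ∀ m p → anyBelow m p ≡ false → ∀ e → e < m → p e ≡ false
  anyBelow-false m p none e e<m with p e in pe
  ... | false = refl
  ... | true  = ⊥-elim (true≢false (anyBelow-intro m p e e<m pe) none)

  anyBelow-none : ∀ m p → (∀ e → e < m → p e ≡ false) → anyBelow m p ≡ false
  anyBelow-none m p none with anyBelow m p in any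
  ... | false = refl
  ... | true with anyBelow-elim m p any
  ...   | e , e<m , pe = ⊥-elim (true≢false pe (none e e<m))

  anyBelow-cong : ∀ m {p q : ℕ → Bool} → (∀ e → e < m → p e ≡ q e) → anyBelow m p ≡ anyBelow m q
  anyBelow-cong zero    p≗q = refl
  anyBelow-cong (suc m) p≗q = cong₂ _∨_ (anyBelow-cong m (λ e e<m → p≗q e (m<n⇒m<1+n e<m))) (p≗q m ≤-refl)

  IsLeast : (ℕ → Bool) → ℕ → Set
  IsLeast p i = p i ≡ true × (∀ j → j < i → p j ≡ false)

  least-or-none : ∀ (p : ℕ → Bool) m → (∃ λ i → i ≤ m × IsLeast p i) ⊎ (∀ j → j ≤ m → p j ≡ false)
  least-or-none p zero with p 0 in p0
  ... | true  = inj₁ (0 , z≤n , p0 , λ _ ())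
  ... | false = inj₂ λ { zero _ → p0 }
  least-or-none p (suc m) with least-or-none p m
  ... | inj₁ (i , i≤m , least) = inj₁ (i , m≤n⇒m≤1+n i≤m , least)
  ... | inj₂ none with p (suc m) in pm
  ...   | true  = inj₁ (suc m , ≤-refl , pm , λ j j<1+m → none j (s≤s⁻¹ j<1+m))
  ...   | false = inj₂ none′
    where
    none′ : ∀ j → j ≤ suc m → p j ≡ false
    none′ j j≤1+m with m≤n⇒m<n∨m≡n j≤1+m
    ... | inj₁ j<1+m = none j (s≤s⁻¹ j<1+m)
    ... | inj₂ refl  = pm

  least-witness : ∀ (p : ℕ → Bool) m → p m ≡ true → ∃ λ i → i ≤ m × IsLeast p i
  least-witness p m pm with least-or-none p m
  ... | inj₁ least = least
  ... | inj₂ none  = ⊥-elim (true≢false pm (none m ≤-refl))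

open BoundedSearch

module Congruence (n : ℕ) .{{_ : NonZero n}} where

  infix 4 _≈_
  _≈_ : ℕ → ℕ → Set
  a ≈ b = a % n ≡ b % n

  ≈-refl : ∀ {a} → a ≈ a
  ≈-refl = refl

  ≈-reflexive : ∀ {a b} → a ≡ b → a ≈ b
  ≈-reflexive = cong (_% n)

  ≈-sym : ∀ {a b} → a ≈ b → b ≈ a
  ≈-sym = sym

  ≈-trans : ∀ {a b c} → a ≈ b → b ≈ c → a ≈ c
  ≈-trans = trans

  ≈-setoid : Setoid 0ℓ 0ℓ
  ≈-setoid = record
    { Carrier = ℕ ; _≈_ = _≈_
    ; isEquivalence = record { refl = ≈-refl ; sym = ≈-sym ; trans = ≈-trans } }

  module ≈-Reasoning = SetoidReasoning ≈-setoid

  ≈-% : ∀ a → a % n ≈ a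
  ≈-% a = m%n%n≡m%n a n

  ≈-+ : ∀ {a b c d} → a ≈ b → c ≈ d → a + c ≈ b + d
  ≈-+ {a} {b} {c} {d} a≈b c≈d = begin
    (a + c) % n             ≡⟨ %-distribˡ-+ a c n ⟩
    (a % n + c % n) % n     ≡⟨ cong₂ (λ x y → (x + y) % n) a≈b c≈d ⟩
    (b % n + d % n) % n     ≡⟨ %-distribˡ-+ b d n ⟨
    (b + d) % n             ∎
    where open ≡-Reasoning

  ≈-*ʳ : ∀ {a b} c → a ≈ b → a * c ≈ b * c
  ≈-*ʳ {a} {b} c a≈b = begin
    (a * c) % n             ≡⟨ %-distribˡ-* a c n ⟩
    (a % n * (c % n)) % n   ≡⟨ cong (λ x → (x * (c % n)) % n) a≈b ⟩
    (b % n * (c % n)) % n   ≡⟨ %-distribˡ-* b c n ⟨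
    (b * c) % n             ∎
    where open ≡-Reasoning

  ≈-*ˡ : ∀ {a b} c → a ≈ b → c * a ≈ c * b
  ≈-*ˡ {a} {b} c a≈b = subst₂ _≈_ (*-comm a c) (*-comm b c) (≈-*ʳ c a≈b)

  ≈-kn : ∀ a k → a + k * n ≈ a
  ≈-kn a k = [m+kn]%n≡m%n a k n

  ≈-n : ∀ a → a + n ≈ a
  ≈-n a = [m+n]%n≡m%n a n

  ≈-< : ∀ {a b} → a < n → b < n → a ≈ b → a ≡ b
  ≈-< {a} {b} a<n b<n a≈b = trans (sym (m<n⇒m%n≡m a<n)) (trans a≈b (m<n⇒m%n≡m b<n))

  ≈-cancelˡ : ∀ c {a b} → c + a ≈ c + b → a ≈ b
  ≈-cancelˡ c {a} {b} c+a≈c+b = begin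
    a % n                             ≡⟨ ≈-+ negate-c (≈-refl {a}) ⟨
    ((n ∸ c % n) + c + a) % n         ≡⟨ ≈-reflexive (+-assoc (n ∸ c % n) c a) ⟩
    ((n ∸ c % n) + (c + a)) % n       ≡⟨ ≈-+ (≈-refl {n ∸ c % n}) c+a≈c+b ⟩
    ((n ∸ c % n) + (c + b)) % n       ≡⟨ ≈-reflexive (+-assoc (n ∸ c % n) c b) ⟨
    ((n ∸ c % n) + c + b) % n         ≡⟨ ≈-+ negate-c (≈-refl {b}) ⟩
    b % n                             ∎
    where
    open ≡-Reasoning
    negate-c : (n ∸ c % n) + c ≈ 0
    negate-c = begin
      ((n ∸ c % n) + c) % n           ≡⟨ ≈-+ (≈-refl {n ∸ c % n}) (≈-sym (≈-% c)) ⟩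
      ((n ∸ c % n) + c % n) % n       ≡⟨ cong (_% n) (m∸n+n≡m (<⇒≤ (m%n<n c n))) ⟩
      n % n                           ≡⟨ n%n≡0 n ⟩
      0                               ≡⟨ m*n%n≡0 0 n ⟨
      0 % n                           ∎

  ≈-cancelʳ : ∀ c {a b} → a + c ≈ b + c → a ≈ b
  ≈-cancelʳ c {a} {b} a+c≈b+c = ≈-cancelˡ c (subst₂ _≈_ (+-comm a c) (+-comm b c) a+c≈b+c)

  ≈-via : ∀ {a b c} d → a + d ≈ c → b + d ≈ c → a ≈ b
  ≈-via d a+d≈c b+d≈c = ≈-cancelʳ d (≈-trans a+d≈c (≈-sym b+d≈c))

  ≈-negate : ∀ {a b} → a + b ≈ 0 → a ≈ (n ∸ 1) * b
  ≈-negate {a} {b} a+b≈0 = begin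
    a                             ≈⟨ ≈-kn a b ⟨
    a + b * n                     ≡⟨ cong (λ k → a + b * k) (sym (m∸n+n≡m (n≢0⇒n>0 (≢-nonZero⁻¹ n)))) ⟩
    a + b * ((n ∸ 1) + 1)         ≡⟨ regroup a b (n ∸ 1) ⟩
    (a + b) + (n ∸ 1) * b         ≈⟨ ≈-+ a+b≈0 (≈-refl {(n ∸ 1) * b}) ⟩
    (n ∸ 1) * b                   ∎
    where
    open ≈-Reasoning
    regroup : ∀ a b m → a + b * (m + 1) ≡ (a + b) + m * b
    regroup = solve-∀

  [w+[n∸i]]+i≈w : ∀ w i → i ≤ n → (w + (n ∸ i)) + i ≈ w
  [w+[n∸i]]+i≈w w i i≤n = ≈-trans (≈-reflexive (trans (+-assoc w _ i) (cong (w +_) (m∸n+n≡m i≤n)))) (≈-n w)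

  [w+i]+[n∸i]≈w : ∀ w i → i ≤ n → (w + i) + (n ∸ i) ≈ w
  [w+i]+[n∸i]≈w w i i≤n = ≈-trans (≈-reflexive (trans (+-assoc w i _) (cong (w +_) (m+[n∸m]≡n i≤n)))) (≈-n w)

  w+[n∸i]≈w∸i : ∀ w i → i ≤ n → i ≤ w → w + (n ∸ i) ≈ w ∸ i
  w+[n∸i]≈w∸i w i i≤n i≤w = ≈-via i ([w+[n∸i]]+i≈w w i i≤n) (≈-reflexive (m∸n+n≡m i≤w))

  [w+[n∸i]]+[n∸j]≈w+[n∸[i+j]] : ∀ w i j → i + j ≤ n → (w + (n ∸ i)) + (n ∸ j) ≈ w + (n ∸ (i + j))
  [w+[n∸i]]+[n∸j]≈w+[n∸[i+j]] w i j i+j≤n = ≈-via (i + j) (begin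
    w + (n ∸ i) + (n ∸ j) + (i + j)     ≡⟨ regroup (w + (n ∸ i)) (n ∸ j) i j ⟩
    w + (n ∸ i) + (n ∸ j) + j + i       ≈⟨ ≈-+ ([w+[n∸i]]+i≈w (w + (n ∸ i)) j (≤-trans (m≤n+m j i) i+j≤n)) (≈-refl {i}) ⟩
    w + (n ∸ i) + i                     ≈⟨ [w+[n∸i]]+i≈w w i (≤-trans (m≤m+n i j) i+j≤n) ⟩
    w                                   ∎)
    ([w+[n∸i]]+i≈w w (i + j) i+j≤n)
    where
    open ≈-Reasoning
    regroup : ∀ x y i j → x + y + (i + j) ≡ x + y + j + i
    regroup = solve-∀

  [w+[n∸i]]+d≈w+[n∸[i∸d]] : ∀ w i d → d ≤ i → i ≤ n → (w + (n ∸ i)) + d ≈ w + (n ∸ (i ∸ d))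
  [w+[n∸i]]+d≈w+[n∸[i∸d]] w i d d≤i i≤n = ≈-via (i ∸ d) (begin
    w + (n ∸ i) + d + (i ∸ d)           ≡⟨ +-assoc (w + (n ∸ i)) d (i ∸ d) ⟩
    w + (n ∸ i) + (d + (i ∸ d))         ≡⟨ cong (w + (n ∸ i) +_) (m+[n∸m]≡n d≤i) ⟩
    w + (n ∸ i) + i                     ≈⟨ [w+[n∸i]]+i≈w w i i≤n ⟩
    w                                   ∎)
    ([w+[n∸i]]+i≈w w (i ∸ d) (≤-trans (m∸n≤m i d) i≤n))
    where open ≈-Reasoning

  ι : ℕ → Fin n
  ι a = a mod n

  toℕ-ι : ∀ a → toℕ (ι a) ≡ a % n
  toℕ-ι a = toℕ-fromℕ< (m%n<n a n)

  ι-≈ : ∀ a → toℕ (ι a) ≈ a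
  ι-≈ a = trans (cong (_% n) (toℕ-ι a)) (≈-% a)

  ι-cong : ∀ {a b} → a ≈ b → ι a ≡ ι b
  ι-cong {a} {b} a≈b = toℕ-injective (trans (toℕ-ι a) (trans a≈b (sym (toℕ-ι b))))

  ι-injective : ∀ {a b} → ι a ≡ ι b → a ≈ b
  ι-injective {a} {b} e = trans (sym (toℕ-ι a)) (trans (cong toℕ e) (toℕ-ι b))

  ≡ι⇒≈ : ∀ {x a} → x ≡ ι a → toℕ x ≈ a
  ≡ι⇒≈ {a = a} refl = ι-≈ a

  ι-toℕ : ∀ (x : Fin n) → ι (toℕ x) ≡ x
  ι-toℕ x = toℕ-injective (trans (toℕ-ι _) (m<n⇒m%n≡m (toℕ<n x)))

module Periodicity (n : ℕ) .{{_ : NonZero n}} where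
  open Congruence n

  Periodic : (ℕ → Bool) → Set
  Periodic χ = ∀ {a b} → a ≈ b → χ a ≡ χ b

  unit-cancel : ∀ {r w} → w * r ≈ 1 → ∀ {u v} → u * r ≈ v * r → u ≈ v
  unit-cancel {r} {w} wr≈1 {u} {v} ur≈vr = begin
    u                 ≡⟨ *-identityʳ u ⟨
    u * 1             ≈⟨ ≈-*ˡ u wr≈1 ⟨
    u * (w * r)       ≡⟨ reassoc u w r ⟩
    u * r * w         ≈⟨ ≈-*ʳ w ur≈vr ⟩
    v * r * w         ≡⟨ reassoc v w r ⟨
    v * (w * r)       ≈⟨ ≈-*ˡ v wr≈1 ⟩
    v * 1             ≡⟨ *-identityʳ v ⟩
    v                 ∎
    where
    open ≈-Reasoning
    reassoc : ∀ u w r → u * (w * r) ≡ u * r * w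
    reassoc = solve-∀

  -- The affine map u ↦ c + u r is a bijection of ℤ/n when r is a unit; its inverse is
  -- v ↦ (v − c) w, with − c represented by (n ∸ 1) c.
  affine-inverse : ∀ {r w} → w * r ≈ 1 → ∀ c v → c + ((v + (n ∸ 1) * c) * w) % n * r ≈ v
  affine-inverse {r} {w} wr≈1 c v = begin
    c + ((v + m * c) * w) % n * r     ≈⟨ ≈-+ (≈-refl {c}) (≈-*ʳ r (≈-% ((v + m * c) * w))) ⟩
    c + (v + m * c) * w * r           ≡⟨ reassoc c v m w r ⟩
    c + (v + m * c) * (w * r)         ≈⟨ ≈-+ (≈-refl {c}) (≈-*ˡ (v + m * c) wr≈1) ⟩
    c + (v + m * c) * 1               ≡⟨ collect c v m ⟩
    v + c * (m + 1)                   ≡⟨ cong (λ k → v + c * k) (trans (+-comm m 1) (suc-pred n)) ⟩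
    v + c * n                         ≈⟨ ≈-kn v c ⟩
    v                                 ∎
    where
    open ≈-Reasoning
    m = n ∸ 1
    reassoc : ∀ c v m w r → c + (v + m * c) * w * r ≡ c + (v + m * c) * (w * r)
    reassoc = solve-∀
    collect : ∀ c v m → c + (v + m * c) * 1 ≡ v + c * (m + 1)
    collect = solve-∀

  count-affine : ∀ (χ : ℕ → Bool) → Periodic χ → ∀ c {r w} → w * r ≈ 1 →
                 count n (λ u → χ (c + u * r)) ≡ count n χ
  count-affine χ χ-periodic c {r} {w} wr≈1 = ≤-antisym forward backward
    where
    forward : count n (λ u → χ (c + u * r)) ≤ count n χ
    forward = count-injection n n _ χ (λ u → (c + u * r) % n)
      (λ u _ χu → m%n<n _ n , trans (χ-periodic (≈-% _)) χu)
      (λ u v u<n v<n _ _ e → ≈-< u<n v<n (unit-cancel {r} {w} wr≈1 (≈-cancelˡ c e)))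
    backward : count n χ ≤ count n (λ u → χ (c + u * r))
    backward = count-injection n n χ _ (λ v → ((v + (n ∸ 1) * c) * w) % n)
      (λ v _ χv → m%n<n _ n , trans (χ-periodic (affine-inverse wr≈1 c v)) χv)
      (λ u v u<n v<n _ _ e → ≈-< u<n v<n (≈-trans (≈-sym (affine-inverse wr≈1 c u))
         (≈-trans (≈-reflexive (cong (λ k → c + k * r) e)) (affine-inverse wr≈1 c v))))

  count-≡⇒⊇ : ∀ (χ ψ : ℕ → Bool) → Periodic χ → Periodic ψ → (∀ u → χ u ≡ true → ψ u ≡ true) →
              count n χ ≡ count n ψ → ∀ u → ψ u ≡ true → χ u ≡ true
  count-≡⇒⊇ χ ψ χ-periodic ψ-periodic χ⊆ψ same u ψu with χ u in χu
  ... | true  = refl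
  ... | false = ⊥-elim (<-irrefl same (count-< n χ ψ (u % n) (m%n<n u n) (λ v _ → χ⊆ψ v)
                  (trans (ψ-periodic (≈-% u)) ψu) (trans (χ-periodic (≈-% u)) χu)))

  count-translate : ∀ (χ : ℕ → Bool) → Periodic χ → ∀ c → count n (λ u → χ (c + u)) ≡ count n χ
  count-translate χ χ-periodic c =
    trans (count-cong n (λ u _ → cong (λ k → χ (c + k)) (sym (*-identityʳ u))))
          (count-affine χ χ-periodic c {1} {1} ≈-refl)

module Sumset (n : ℕ) .{{_ : NonZero n}} (K J : ℕ) (ρ : ℕ → Bool) where
  open Congruence n
  open Periodicity n

  -- In r-coordinates S − a is {0, …, K} ∖ {J}; with D = {1, …, K} ∖ {J} the sumset S + T
  -- becomes ρ ∪ (ρ + D).  A difference w − d is represented by w + (n ∸ d).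
  ρ+D : ℕ → Bool
  ρ+D w = anyBelow K (λ e → not (does (suc e ≟ J)) ∧ ρ (w + (n ∸ suc e)))

  hole : ℕ → Bool
  hole w = not (ρ w)

  bad : ℕ → Bool
  bad w = hole w ∧ ρ+D w

  isolated : ℕ → Bool
  isolated t = ρ t ∧ (not (anyBelow J (λ e → ρ (t + suc e)))
                   ∧ not (anyBelow (K ∸ J) (λ e → ρ (t + (n ∸ suc e)))))

  count-ρ∪ρ+D : count n (λ w → ρ w ∨ ρ+D w) ≡ count n ρ + count n bad
  count-ρ∪ρ+D = trans (count-cong n (λ w _ → split (ρ w)))
    (count-∨-disjoint n ρ bad (λ u _ ρu bad-u → true≢false ρu (not-true (∧-conicalˡ (hole u) _ bad-u))))
    where
    split : ∀ {b} a → a ∨ b ≡ a ∨ (not a ∧ b)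
    split true  = refl
    split false = refl

  count-ρ+hole : count n ρ + count n hole ≡ n
  count-ρ+hole = begin
    count n ρ + count n hole            ≡⟨ count-∨-disjoint n ρ hole (λ u _ ρu hole-u → true≢false ρu (not-true hole-u)) ⟨
    count n (λ u → ρ u ∨ not (ρ u))     ≡⟨ count-cong n (λ u _ → ∨-inverseʳ (ρ u)) ⟩
    count n (λ _ → true)                ≡⟨ count-true n ⟩
    n                                   ∎
    where open ≡-Reasoning

  count-D : ∀ (f : ℕ → Bool) → 1 ≤ J → J ≤ K → (∀ d → 1 ≤ d → d ≤ K → d ≢ J → f d ≡ true) →
            K ≤ suc (count K (λ e → f (suc e)))
  count-D f (s≤s {_} {J-1} _) J≤K on-D =
    subst (_≤ suc (count K (λ e → f (suc e)))) (trans (count-except K J-1 (λ _ → true) J≤K refl) (count-true K))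
      (s≤s (count-mono K (λ e e<K e≢J-1 → on-D (suc e) (s≤s z≤n) e<K
             (λ { refl → true≢false (dec-true (J-1 ≟ J-1) refl) (not-true e≢J-1) }))))

  module Properties (ρ-periodic : Periodic ρ) where

    ρ-+-cong : ∀ {a b} c → a ≈ b → ρ (a + c) ≡ ρ (b + c)
    ρ-+-cong c a≈b = ρ-periodic (≈-+ a≈b (≈-refl {c}))

    hole-periodic : Periodic hole
    hole-periodic a≈b = cong not (ρ-periodic a≈b)

    bad-periodic : Periodic bad
    bad-periodic a≈b = cong₂ _∧_ (hole-periodic a≈b)
      (anyBelow-cong K (λ e _ → cong (not (does (suc e ≟ J)) ∧_) (ρ-+-cong _ a≈b)))

    isolated-periodic : Periodic isolated
    isolated-periodic a≈b = cong₂ _∧_ (ρ-periodic a≈b) (cong₂ _∧_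
      (cong not (anyBelow-cong J (λ e _ → ρ-+-cong _ a≈b)))
      (cong not (anyBelow-cong (K ∸ J) (λ e _ → ρ-+-cong _ a≈b))))

    isolated⇒ρ : ∀ t → isolated t ≡ true → ρ t ≡ true
    isolated⇒ρ t iso = ∧-conicalˡ (ρ t) _ iso

    isolated-after : ∀ t → isolated t ≡ true → ∀ d → 1 ≤ d → d ≤ J → ρ (t + d) ≡ false
    isolated-after t iso (suc e) _ d≤J =
      anyBelow-false J _ (not-true (∧-conicalˡ _ _ (∧-conicalʳ (ρ t) _ iso))) e d≤J

    isolated-before : ∀ t → isolated t ≡ true → ∀ d → 1 ≤ d → d ≤ K ∸ J → ρ (t + (n ∸ d)) ≡ false
    isolated-before t iso (suc e) _ d≤K-J =
      anyBelow-false (K ∸ J) _ (not-true (∧-conicalʳ _ _ (∧-conicalʳ (ρ t) _ iso))) e d≤K-J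

    isolated-intro : ∀ t → ρ t ≡ true → (∀ d → 1 ≤ d → d ≤ J → ρ (t + d) ≡ false) →
      (∀ d → 1 ≤ d → d ≤ K ∸ J → ρ (t + (n ∸ d)) ≡ false) → isolated t ≡ true
    isolated-intro t ρt after before = cong₂ _∧_ ρt (cong₂ _∧_
      (not-false (anyBelow-none J _ (λ e e<J → after (suc e) (s≤s z≤n) e<J)))
      (not-false (anyBelow-none (K ∸ J) _ (λ e e<K-J → before (suc e) (s≤s z≤n) e<K-J))))

    bad-intro : ∀ w i → 1 ≤ i → i ≤ K → i ≢ J → ρ w ≡ false → ρ (w + (n ∸ i)) ≡ true → bad w ≡ true
    bad-intro w (suc e) _ i≤K i≢J ρw ρw-i = cong₂ _∧_ (not-false ρw)
      (anyBelow-intro K _ e i≤K (cong₂ _∧_ (not-false (dec-false (suc e ≟ J) i≢J)) ρw-i))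

    -- Either i ∈ D, or i = J and some w − j with J < j ≤ K lies in ρ (both make w bad),
    -- or else w − J is isolated.
    hole-bad-or-isolated : J < K → K < n → ∀ w i → 1 ≤ i → i ≤ K → ρ w ≡ false → ρ (w + (n ∸ i)) ≡ true →
      (∀ j → 1 ≤ j → j < i → ρ (w + (n ∸ j)) ≡ false) → bad w ≡ true ⊎ isolated (w + (n ∸ J)) ≡ true
    hole-bad-or-isolated J<K K<n w i 1≤i i≤K ρw ρw-i nearest with i ≟ J
    ... | no i≢J = inj₁ (bad-intro w i 1≤i i≤K i≢J ρw ρw-i)
    ... | yes refl with anyBelow (K ∸ i) (λ e → ρ (w + (n ∸ (i + suc e)))) in further
    ...   | true with anyBelow-elim (K ∸ i) _ further
    ...     | e , e<K-i , ρw-j = inj₁ (bad-intro w (i + suc e) (≤-trans 1≤i (m≤m+n i _)) j≤K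
                                   (λ j≡i → m≢1+m+n i (sym (trans (sym (+-suc i e)) j≡i))) ρw ρw-j)
      where
      j≤K : i + suc e ≤ K
      j≤K = ≤-trans (+-monoʳ-≤ i e<K-i) (≤-reflexive (m+[n∸m]≡n (<⇒≤ J<K)))
    hole-bad-or-isolated J<K K<n w i 1≤i i≤K ρw ρw-i nearest | yes refl | false =
      inj₂ (isolated-intro _ ρw-i after before)
      where
      i≤n = ≤-trans i≤K (<⇒≤ K<n)
      after : ∀ d → 1 ≤ d → d ≤ i → ρ ((w + (n ∸ i)) + d) ≡ false
      after d 1≤d d≤i with m≤n⇒m<n∨m≡n d≤i
      ... | inj₂ refl = trans (ρ-periodic ([w+[n∸i]]+i≈w w d i≤n)) ρw
      ... | inj₁ d<i  = trans (ρ-periodic ([w+[n∸i]]+d≈w+[n∸[i∸d]] w i d d≤i i≤n))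
                              (nearest (i ∸ d) (m<n⇒0<n∸m d<i) (∸-monoʳ-< {i} {d} {0} 1≤d d≤i))
      before : ∀ d → 1 ≤ d → d ≤ K ∸ i → ρ ((w + (n ∸ i)) + (n ∸ d)) ≡ false
      before (suc e) _ d≤K-i = trans (ρ-periodic ([w+[n∸i]]+[n∸j]≈w+[n∸[i+j]] w i (suc e) i+d≤n))
                                     (anyBelow-false (K ∸ i) _ further e d≤K-i)
        where
        i+d≤n : i + suc e ≤ n
        i+d≤n = ≤-trans (+-monoʳ-≤ i d≤K-i) (≤-trans (≤-reflexive (m+[n∸m]≡n (<⇒≤ J<K))) (<⇒≤ K<n))

    hole-covered : J < K → K < n → ∀ w m → m ≤ n → ρ w ≡ false → ρ (w + (n ∸ m)) ≡ true →
      (∀ i → 1 ≤ i → i ≤ m → ρ (w + (n ∸ i)) ≡ true → ∃ λ d → 1 ≤ d × d ≤ K × ρ (w + (n ∸ i) + d) ≡ true) →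
      bad w ≡ true ⊎ isolated (w + (n ∸ J)) ≡ true
    hole-covered J<K K<n w zero    _   ρw ρw-0 _ =
      ⊥-elim (true≢false (trans (ρ-periodic (≈-sym (≈-n w))) ρw-0) ρw)
    hole-covered J<K K<n w (suc m) m≤n ρw ρw-m successor
      with least-witness (λ i → ρ (w + (n ∸ suc i))) m ρw-m
    ... | i , i≤m , ρw-i , nearest with suc i ≤? K
    ...   | yes i<K = hole-bad-or-isolated J<K K<n w (suc i) (s≤s z≤n) i<K ρw ρw-i
                        (λ { (suc j) _ j<i → nearest j (s≤s⁻¹ j<i) })
    ...   | no  i≮K with successor (suc i) (s≤s z≤n) (s≤s i≤m) ρw-i
    ...     | d , 1≤d , d≤K , ρt+d = ⊥-elim (true≢false (trans (sym (ρ-periodic t+d≈w-j)) ρt+d) (nearest (i ∸ d) i∸d<i))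
      where
      d≤i : d ≤ i
      d≤i = ≤-trans d≤K (s≤s⁻¹ (≰⇒> i≮K))
      i∸d<i : i ∸ d < i
      i∸d<i = ∸-monoʳ-< {i} {d} {0} 1≤d d≤i
      t+d≈w-j : w + (n ∸ suc i) + d ≈ w + (n ∸ suc (i ∸ d))
      t+d≈w-j = subst (λ k → w + (n ∸ suc i) + d ≈ w + (n ∸ k)) (+-∸-assoc 1 d≤i)
                  ([w+[n∸i]]+d≈w+[n∸[i∸d]] w (suc i) d (m≤n⇒m≤1+n d≤i) (≤-trans (s≤s i≤m) m≤n))

    isolated-apart : 3 ≤ K → 2 ≤ n → ∀ t → isolated t ≡ true → isolated (t + 2) ≡ true → ⊥
    isolated-apart K≥3 2≤n t iso-t iso-t+2 with 2 ≤? J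
    ... | yes 2≤J = true≢false (isolated⇒ρ _ iso-t+2) (isolated-after t iso-t 2 (s≤s z≤n) 2≤J)
    ... | no  2≰J = true≢false (isolated⇒ρ t iso-t)
                      (trans (ρ-periodic (≈-sym ([w+i]+[n∸i]≈w t 2 2≤n))) (isolated-before (t + 2) iso-t+2 2 (s≤s z≤n) 2≤K∸J))
      where
      2≤K∸J : 2 ≤ K ∸ J
      2≤K∸J = ≤-trans (∸-monoˡ-≤ 1 K≥3) (∸-monoʳ-≤ K (s≤s⁻¹ (≰⇒> 2≰J)))

module Shapes (n : ℕ) where

  IsInitialSegment : (ℕ → Bool) → Set
  IsInitialSegment σ = Σ ℕ λ L → L < n ×
    (∀ u → u < n → σ u ≡ true → u ≤ L) × (∀ u → u ≤ L → σ u ≡ true)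

  IsPuncturedSegment : (ℕ → Bool) → Set
  IsPuncturedSegment σ = Σ ℕ λ L → Σ ℕ λ h → 0 < h × h < L × L < n ×
    (∀ u → u < n → σ u ≡ true → u ≤ L × u ≢ h) × (∀ u → u ≤ L → u ≢ h → σ u ≡ true)

  SomeTranslate : ((ℕ → Bool) → Set) → (ℕ → Bool) → Set
  SomeTranslate P σ = Σ ℕ λ b → P (λ u → σ (b + u))

  IsMultiplesOf3 : (ℕ → Bool) → Set
  IsMultiplesOf3 σ = (∀ u → σ u ≡ true → u % 3 ≡ 0) × (∀ u → u % 3 ≡ 0 → σ u ≡ true)

open Periodicity using (Periodic)

module GapCase (n : ℕ) .{{_ : NonZero n}} (K J : ℕ) (ρ : ℕ → Bool) (ρ-periodic : Periodic n ρ)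
  (J≥1 : 1 ≤ J) (J<K : J < K) (K≥3 : 3 ≤ K) (L : ℕ) (L+K<n : L + K < n)
  (ρ0 : ρ 0 ≡ true) (ρL : ρ L ≡ true) (beyond-L : ∀ u → L < u → u < n → ρ u ≡ false)
  (few-bad : count n (Sumset.bad n K J ρ) ≤ K) (three : 3 ≤ count n ρ) where

  open Congruence n
  open Shapes n
  open Sumset n K J ρ
  open Properties ρ-periodic

  K<n : K < n
  K<n = ≤-trans (s≤s (m≤n+m K L)) L+K<n

  L<n : L < n
  L<n = ≤-trans (s≤s (m≤m+n L K)) L+K<n

  J≤K : J ≤ K
  J≤K = <⇒≤ J<K

  K≤n : K ≤ n
  K≤n = <⇒≤ K<n

  1≤n : 1 ≤ n
  1≤n = ≤-trans (s≤s z≤n) K<n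

  2≤n : 2 ≤ n
  2≤n = ≤-trans (≤-trans (s≤s (s≤s z≤n)) K≥3) K≤n

  ρ-after-L : ∀ d → 1 ≤ d → d ≤ K → ρ (L + d) ≡ false
  ρ-after-L d 1≤d d≤K = beyond-L (L + d) (m<m+n L 1≤d) (≤-trans (s≤s (+-monoʳ-≤ L d≤K)) L+K<n)

  bad-after-L : ∀ d → 1 ≤ d → d ≤ K → d ≢ J → bad (L + d) ≡ true
  bad-after-L d 1≤d d≤K d≢J = bad-intro (L + d) d 1≤d d≤K d≢J (ρ-after-L d 1≤d d≤K)
    (trans (ρ-periodic ([w+i]+[n∸i]≈w L d (≤-trans d≤K K≤n))) ρL)

  isolated-L : bad (L + J) ≡ false → isolated L ≡ true
  isolated-L L+J-not-bad = isolated-intro L ρL (λ d 1≤d d≤J → ρ-after-L d 1≤d (≤-trans d≤J J≤K)) before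
    where
    before : ∀ d → 1 ≤ d → d ≤ K ∸ J → ρ (L + (n ∸ d)) ≡ false
    before d 1≤d d≤K∸J with ρ (L + (n ∸ d)) in ρL-d
    ... | false = refl
    ... | true  = ⊥-elim (true≢false L+J-bad L+J-not-bad)
      where
      J+d≤K : J + d ≤ K
      J+d≤K = ≤-trans (+-monoʳ-≤ J d≤K∸J) (≤-reflexive (m+[n∸m]≡n J≤K))
      L+J-d≈L-d : (L + J) + (n ∸ (J + d)) ≈ L + (n ∸ d)
      L+J-d≈L-d = begin
        L + J + (n ∸ (J + d))      ≡⟨ trans (+-assoc L J _) (trans (cong (L +_) (+-comm J _)) (sym (+-assoc L _ J))) ⟩
        L + (n ∸ (J + d)) + J      ≈⟨ [w+[n∸i]]+d≈w+[n∸[i∸d]] L (J + d) J (m≤m+n J d) (≤-trans J+d≤K K≤n) ⟩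
        L + (n ∸ (J + d ∸ J))      ≡⟨ cong (λ k → L + (n ∸ k)) (m+n∸m≡n J d) ⟩
        L + (n ∸ d)                ∎
        where open ≈-Reasoning
      L+J-bad : bad (L + J) ≡ true
      L+J-bad = bad-intro (L + J) (J + d) (≤-trans J≥1 (m≤m+n J d)) J+d≤K (>⇒≢ (m<m+n J 1≤d))
                  (ρ-after-L J J≥1 J≤K) (trans (ρ-periodic L+J-d≈L-d) ρL-d)

  bad-after-L-count : K ≤ count K (λ e → bad (L + suc e)) + indicator (isolated L)
  bad-after-L-count with isolated L in iso-L
  ... | true = subst (K ≤_) (+-comm 1 _) (count-D (λ d → bad (L + d)) J≥1 J≤K bad-after-L)
  ... | false with bad (L + J) in L+J-bad
  ...   | false = ⊥-elim (true≢false (isolated-L L+J-bad) iso-L)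
  ...   | true  = subst (K ≤_) (sym (+-identityʳ _))
                    (subst (_≤ count K (λ e → bad (L + suc e))) (count-true K)
                      (count-mono K (λ e e<K _ → all-bad e e<K)))
    where
    all-bad : ∀ e → e < K → bad (L + suc e) ≡ true
    all-bad e e<K with suc e ≟ J
    ... | yes refl = L+J-bad
    ... | no  e≢J  = bad-after-L (suc e) (s≤s z≤n) e<K e≢J

  bad-up-to-L : count (suc L) bad ≤ indicator (isolated L)
  bad-up-to-L = +-cancelʳ-≤ K _ _ (begin
    count (suc L) bad + K
      ≤⟨ +-monoʳ-≤ (count (suc L) bad) bad-after-L-count ⟩
    count (suc L) bad + (count K (λ e → bad (L + suc e)) + indicator (isolated L))
      ≡⟨ +-assoc (count (suc L) bad) _ _ ⟨
    count (suc L) bad + count K (λ e → bad (L + suc e)) + indicator (isolated L)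
      ≤⟨ +-monoˡ-≤ (indicator (isolated L)) bad-split ⟩
    count n bad + indicator (isolated L)
      ≤⟨ +-monoˡ-≤ (indicator (isolated L)) few-bad ⟩
    K + indicator (isolated L)
      ≡⟨ +-comm K _ ⟩
    indicator (isolated L) + K ∎)
    where
    open ≤-Reasoning
    bad-split : count (suc L) bad + count K (λ e → bad (L + suc e)) ≤ count n bad
    bad-split = subst (λ c → count (suc L) bad + c ≤ count n bad)
      (count-cong K (λ u _ → cong bad (sym (+-suc L u))))
      (count-window (suc L) K n bad L+K<n)

  -- A gap of length K after t < L would make the K − 1 points t + D bad as well.
  no-inner-gap : ∀ t → t < L → ρ t ≡ true → ∃ λ d → 1 ≤ d × d ≤ K × ρ (t + d) ≡ true
  no-inner-gap t t<L ρt with anyBelow K (λ e → ρ (t + suc e)) in successor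
  ... | true with anyBelow-elim K _ successor
  ...   | e , e<K , ρt+d = suc e , s≤s z≤n , e<K , ρt+d
  no-inner-gap t t<L ρt | false = ⊥-elim (<⇒≱ K≥3 K≤2)
    where
    gap : ∀ d → 1 ≤ d → d ≤ K → ρ (t + d) ≡ false
    gap (suc e) _ d≤K = anyBelow-false K _ successor e d≤K
    t+K<L : suc t + K ≤ suc L
    t+K<L with suc t + K ≤? suc L
    ... | yes le = le
    ... | no  gt = ⊥-elim (true≢false ρL (subst (λ u → ρ u ≡ false) (m+[n∸m]≡n (<⇒≤ t<L))
                     (gap (L ∸ t) (m<n⇒0<n∸m t<L) L∸t≤K)))
      where
      L∸t≤K : L ∸ t ≤ K
      L∸t≤K = ≤-trans (∸-monoˡ-≤ t (s≤s⁻¹ (<⇒≤ (≰⇒> gt)))) (≤-reflexive (m+n∸m≡n t K))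
    bad-after-t : ∀ d → 1 ≤ d → d ≤ K → d ≢ J → bad (t + d) ≡ true
    bad-after-t d 1≤d d≤K d≢J = bad-intro (t + d) d 1≤d d≤K d≢J (gap d 1≤d d≤K)
      (trans (ρ-periodic ([w+i]+[n∸i]≈w t d (≤-trans d≤K K≤n))) ρt)
    K≤2 : K ≤ 2
    K≤2 = begin
      K                                        ≤⟨ count-D (λ d → bad (t + d)) J≥1 J≤K bad-after-t ⟩
      suc (count K (λ e → bad (t + suc e)))    ≡⟨ cong suc (count-cong K (λ u _ → cong bad (sym (+-suc t u)))) ⟨
      suc (count K (λ u → bad (suc t + u)))    ≤⟨ s≤s (≤-trans (m≤n+m _ _) (count-window (suc t) K (suc L) bad t+K<L)) ⟩
      suc (count (suc L) bad)                  ≤⟨ s≤s (≤-trans bad-up-to-L (indicator≤1 _)) ⟩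
      2                                        ∎
      where open ≤-Reasoning

  hole-up-to-L : ∀ w → w ≤ L → ρ w ≡ false → bad w ≡ true ⊎ isolated (w + (n ∸ J)) ≡ true
  hole-up-to-L w w≤L ρw = hole-covered J<K K<n w w w≤n ρw ρw-w successor
    where
    w≤n = ≤-trans w≤L (<⇒≤ L<n)
    ρw-w : ρ (w + (n ∸ w)) ≡ true
    ρw-w = trans (cong ρ (m+[n∸m]≡n w≤n)) (trans (ρ-periodic (≈-n 0)) ρ0)
    successor : ∀ i → 1 ≤ i → i ≤ w → ρ (w + (n ∸ i)) ≡ true →
                ∃ λ d → 1 ≤ d × d ≤ K × ρ (w + (n ∸ i) + d) ≡ true
    successor i 1≤i i≤w ρw-i
      with no-inner-gap (w ∸ i) (≤-trans (∸-monoʳ-< {w} {i} {0} 1≤i i≤w) w≤L)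
             (trans (ρ-periodic (≈-sym (w+[n∸i]≈w∸i w i (≤-trans i≤w w≤n) i≤w))) ρw-i)
    ... | d , 1≤d , d≤K , ρt+d = d , 1≤d , d≤K , trans (ρ-+-cong d (w+[n∸i]≈w∸i w i (≤-trans i≤w w≤n) i≤w)) ρt+d

  J≤w-if-isolated : ∀ w → w ≤ L → isolated (w + (n ∸ J)) ≡ true → J ≤ w
  J≤w-if-isolated w w≤L iso with J ≤? w
  ... | yes J≤w = J≤w
  ... | no  J≰w = ⊥-elim (true≢false (isolated⇒ρ _ iso) (beyond-L _ L<w-J w-J<n))
    where
    J≤n = ≤-trans J≤K K≤n
    L<w-J : L < w + (n ∸ J)
    L<w-J = ≤-trans (+-cancelʳ-≤ J (suc L) (n ∸ J)
              (≤-trans (≤-trans (s≤s (+-monoʳ-≤ L J≤K)) L+K<n) (≤-reflexive (sym (m∸n+n≡m J≤n)))))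
              (m≤n+m (n ∸ J) w)
    w-J<n : w + (n ∸ J) < n
    w-J<n = ≤-trans (+-monoˡ-≤ (n ∸ J) (≰⇒> J≰w)) (≤-reflexive (m+[n∸m]≡n J≤n))

  isolated-J-before-≤ : count (suc L) (λ w → isolated (w + (n ∸ J))) ≤ count L isolated
  isolated-J-before-≤ = count-injection (suc L) L _ isolated (_∸ J) maps injective
    where
    J≤n = ≤-trans J≤K K≤n
    maps : ∀ w → w < suc L → isolated (w + (n ∸ J)) ≡ true → w ∸ J < L × isolated (w ∸ J) ≡ true
    maps w w≤L iso = w∸J<L , trans (sym (isolated-periodic (w+[n∸i]≈w∸i w J J≤n J≤w))) iso
      where
      J≤w = J≤w-if-isolated w (s≤s⁻¹ w≤L) iso
      w∸J<L : w ∸ J < L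
      w∸J<L = ≤-trans (≤-trans (≤-reflexive (+-comm 1 (w ∸ J))) (+-monoʳ-≤ (w ∸ J) J≥1))
                      (≤-trans (≤-reflexive (m∸n+n≡m J≤w)) (s≤s⁻¹ w≤L))
    injective : ∀ u v → u < suc L → v < suc L → isolated (u + (n ∸ J)) ≡ true → isolated (v + (n ∸ J)) ≡ true →
                u ∸ J ≡ v ∸ J → u ≡ v
    injective u v u≤L v≤L iso-u iso-v e = begin
      u              ≡⟨ m∸n+n≡m (J≤w-if-isolated u (s≤s⁻¹ u≤L) iso-u) ⟨
      u ∸ J + J      ≡⟨ cong (_+ J) e ⟩
      v ∸ J + J      ≡⟨ m∸n+n≡m (J≤w-if-isolated v (s≤s⁻¹ v≤L) iso-v) ⟩
      v              ∎
      where open ≡-Reasoning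

  holes≤isolated : count (suc L) hole ≤ count (suc L) isolated
  holes≤isolated = begin
    count (suc L) hole
      ≤⟨ count-mono (suc L) (λ w w≤L hole-w → covered w (s≤s⁻¹ w≤L) (not-true hole-w)) ⟩
    count (suc L) (λ w → bad w ∨ isolated (w + (n ∸ J)))
      ≤⟨ count-∨-≤ (suc L) bad (λ w → isolated (w + (n ∸ J))) ⟩
    count (suc L) bad + count (suc L) (λ w → isolated (w + (n ∸ J)))
      ≤⟨ +-mono-≤ bad-up-to-L isolated-J-before-≤ ⟩
    indicator (isolated L) + count L isolated
      ≡⟨ trans (+-comm _ (count L isolated)) (sym (count-suc L isolated)) ⟩
    count (suc L) isolated ∎
    where
    open ≤-Reasoning
    covered : ∀ w → w ≤ L → ρ w ≡ false → bad w ∨ isolated (w + (n ∸ J)) ≡ true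
    covered w w≤L ρw with hole-up-to-L w w≤L ρw
    ... | inj₁ bad-w = cong (_∨ isolated (w + (n ∸ J))) bad-w
    ... | inj₂ iso   = ∨-introʳ (bad w) iso

  isolated-after-L : ∀ u → L < u → u < n → isolated u ≡ false
  isolated-after-L u L<u u<n with isolated u in iso
  ... | false = refl
  ... | true  = ⊥-elim (true≢false (isolated⇒ρ u iso) (beyond-L u L<u u<n))

  isolated-neighbours-apart : ∀ w → isolated (w + (n ∸ 1)) ≡ true → isolated (suc w) ≡ true → ⊥
  isolated-neighbours-apart w iso-left iso-right = isolated-apart K≥3 2≤n (w + (n ∸ 1)) iso-left
    (trans (isolated-periodic t+2≈1+w) iso-right)
    where
    t+2≈1+w : w + (n ∸ 1) + 2 ≈ suc w
    t+2≈1+w = begin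
      w + (n ∸ 1) + 2          ≡⟨ +-assoc (w + (n ∸ 1)) 1 1 ⟨
      w + (n ∸ 1) + 1 + 1      ≈⟨ ≈-+ ([w+[n∸i]]+i≈w w 1 1≤n) (≈-refl {1}) ⟩
      w + 1                    ≡⟨ +-comm w 1 ⟩
      suc w                    ∎
      where open ≈-Reasoning

  -- Each isolated t ≤ L has holes at t − 1 (if t > 0) and t + 1 (if t < L), all distinct.
  isolated-neighbours≤holes : count L isolated + count (suc L) (λ w → isolated (suc w)) ≤ count (suc L) hole
  isolated-neighbours≤holes = begin
    count L isolated + count (suc L) (λ w → isolated (suc w))
      ≡⟨ cong (_+ count (suc L) (λ w → isolated (suc w))) count-left ⟨
    count (suc L) left + count (suc L) (λ w → isolated (suc w))
      ≡⟨ count-∨-disjoint (suc L) left (λ w → isolated (suc w)) (λ w _ → isolated-neighbours-apart w) ⟨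
    count (suc L) (λ w → left w ∨ isolated (suc w))
      ≤⟨ count-mono (suc L) (λ w _ → neighbour-hole w) ⟩
    count (suc L) hole ∎
    where
    open ≤-Reasoning
    left : ℕ → Bool
    left w = isolated (w + (n ∸ 1))
    L<n∸1 : L < n ∸ 1
    L<n∸1 = m+n≤o⇒m≤o∸n (suc L) (≤-trans (s≤s (+-monoʳ-≤ L (≤-trans (s≤s z≤n) J<K))) L+K<n)
    count-left : count (suc L) left ≡ count L isolated
    count-left = cong₂ _+_
      (cong indicator (isolated-after-L (n ∸ 1) L<n∸1 (∸-monoʳ-< {n} {1} {0} (s≤s z≤n) 1≤n)))
      (count-cong L (λ u _ → isolated-periodic (w+[n∸i]≈w∸i (suc u) 1 1≤n (s≤s z≤n))))
    neighbour-hole : ∀ w → left w ∨ isolated (suc w) ≡ true → hole w ≡ true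
    neighbour-hole w iso with ∨-elim (left w) _ iso
    ... | inj₁ iso-left  = not-false (trans (ρ-periodic (≈-sym ([w+[n∸i]]+i≈w w 1 1≤n))) (isolated-after _ iso-left 1 ≤-refl J≥1))
    ... | inj₂ iso-right = not-false (trans (ρ-periodic (≈-sym (w+[n∸i]≈w∸i (suc w) 1 1≤n (s≤s z≤n))))
                                             (isolated-before (suc w) iso-right 1 ≤-refl (m<n⇒0<n∸m J<K)))

  isolated≤endpoints : count (suc L) isolated ≤ indicator (isolated 0) + indicator (isolated L)
  isolated≤endpoints = begin
    count (suc L) isolated                     ≡⟨ count-suc L isolated ⟩
    count L isolated + indicator (isolated L)  ≤⟨ +-monoˡ-≤ (indicator (isolated L)) before-L≤ ⟩
    indicator (isolated 0) + indicator (isolated L) ∎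
    where
    open ≤-Reasoning
    right = count (suc L) (λ w → isolated (suc w))
    before-L≤ : count L isolated ≤ indicator (isolated 0)
    before-L≤ = +-cancelʳ-≤ right _ _ (begin
      count L isolated + right                   ≤⟨ isolated-neighbours≤holes ⟩
      count (suc L) hole                         ≤⟨ holes≤isolated ⟩
      count (suc L) isolated                     ≤⟨ m≤m+n _ _ ⟩
      count (suc L) isolated + indicator (isolated (suc L)) ≡⟨ count-suc (suc L) isolated ⟨
      indicator (isolated 0) + right             ∎)

  ρ-up-to-L : count n ρ ≡ count (suc L) ρ
  ρ-up-to-L = begin
    count n ρ                                             ≡⟨ cong (λ m → count m ρ) (m+[n∸m]≡n L<n) ⟨
    count (suc L + (n ∸ suc L)) ρ                         ≡⟨ count-split (suc L) (n ∸ suc L) ρ ⟩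
    count (suc L) ρ + count (n ∸ suc L) (λ u → ρ (suc L + u)) ≡⟨ cong (count (suc L) ρ +_) (count-false (n ∸ suc L) beyond) ⟩
    count (suc L) ρ + 0                                   ≡⟨ +-identityʳ _ ⟩
    count (suc L) ρ                                       ∎
    where
    open ≡-Reasoning
    beyond : ∀ u → u < n ∸ suc L → ρ (suc L + u) ≡ false
    beyond u u<n∸L = beyond-L (suc L + u) (s≤s (m≤m+n L u))
      (≤-trans (+-monoʳ-< (suc L) u<n∸L) (≤-reflexive (m+[n∸m]≡n L<n)))

  ρ-interior : ∃ λ x → 0 < x × x < L × ρ x ≡ true
  ρ-interior with count-witness (suc L) ((ρ except L) except 0) (s≤s⁻¹ (s≤s⁻¹ (begin
      3                                          ≤⟨ three ⟩
      count n ρ                                  ≡⟨ ρ-up-to-L ⟩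
      count (suc L) ρ                            ≡⟨ count-except (suc L) L ρ ≤-refl ρL ⟨
      suc (count (suc L) (ρ except L))           ≡⟨ cong suc (count-except (suc L) 0 (ρ except L) z<s (except-true ρ ρ0 0≢L)) ⟨
      2 + count (suc L) ((ρ except L) except 0)  ∎)))
    where
    open ≤-Reasoning
    0≢L : 0 ≢ L
    0≢L 0≡L = <⇒≱ three (begin
      count n ρ                   ≡⟨ ρ-up-to-L ⟩
      count (suc L) ρ             ≡⟨ cong (λ m → count (suc m) ρ) 0≡L ⟨
      indicator (ρ 0) + 0         ≤⟨ +-monoˡ-≤ 0 (indicator≤1 (ρ 0)) ⟩
      1                           ≤⟨ n≤1+n 1 ⟩
      2                           ∎)
  ... | x , x≤L , x∈ with except-elim (ρ except L) x∈
  ...   | x∈′ , x≢0 with except-elim ρ x∈′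
  ...     | ρx , x≢L = x , n≢0⇒n>0 x≢0 , ≤∧≢⇒< (s≤s⁻¹ x≤L) x≢L , ρx

  hole-before-L : isolated L ≡ true → ∀ d → 1 ≤ d → d ≤ K ∸ J → d ≤ L → ρ (L ∸ d) ≡ false
  hole-before-L iso-L d 1≤d d≤K∸J d≤L =
    trans (ρ-periodic (≈-sym (w+[n∸i]≈w∸i L d (≤-trans d≤L (<⇒≤ L<n)) d≤L))) (isolated-before L iso-L d 1≤d d≤K∸J)

  three-holes : isolated 0 ≡ true → isolated L ≡ true → 3 ≤ count (suc L) hole
  three-holes iso-0 iso-L with ρ-interior
  ... | x , 0<x , x<L , ρx = around (2 ≤? J)
    where
    hole-1 : ρ 1 ≡ false
    hole-1 = isolated-after 0 iso-0 1 ≤-refl J≥1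
    1<x : 1 < x
    1<x = ≤∧≢⇒< 0<x (separates ρ ρx hole-1 ∘ sym)
    1≤L : 1 ≤ L
    1≤L = ≤-trans 0<x (<⇒≤ x<L)
    hole-L-1 : ρ (L ∸ 1) ≡ false
    hole-L-1 = hole-before-L iso-L 1 ≤-refl (m<n⇒0<n∸m J<K) 1≤L
    x<L-1 : x < L ∸ 1
    x<L-1 = <∧≢-1⇒< x<L (separates ρ ρx hole-L-1)
    around : Dec (2 ≤ J) → 3 ≤ count (suc L) hole
    around (yes 2≤J) = count-≥3 (suc L) hole 1 2 (L ∸ 1) (s≤s 1≤L) (s≤s (<⇒≤ (<-trans 2<x x<L))) (s≤s (m∸n≤m L 1))
                         (λ ()) (<⇒≢ (<-trans 1<x x<L-1)) (<⇒≢ (<-trans 2<x x<L-1))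
                         (not-false hole-1) (not-false hole-2) (not-false hole-L-1)
      where
      hole-2 : ρ 2 ≡ false
      hole-2 = isolated-after 0 iso-0 2 (s≤s z≤n) 2≤J
      2<x : 2 < x
      2<x = ≤∧≢⇒< 1<x (separates ρ ρx hole-2 ∘ sym)
    around (no 2≰J) = count-≥3 (suc L) hole 1 (L ∸ 2) (L ∸ 1) (s≤s 1≤L) (s≤s (m∸n≤m L 2)) (s≤s (m∸n≤m L 1))
                        (<⇒≢ (<-trans 1<x x<L-2)) (<⇒≢ (<-trans 1<x x<L-1)) (<⇒≢ L-2<L-1)
                        (not-false hole-1) (not-false hole-L-2) (not-false hole-L-1)
      where
      2≤K∸J : 2 ≤ K ∸ J
      2≤K∸J = ≤-trans (∸-monoˡ-≤ 1 K≥3) (∸-monoʳ-≤ K (s≤s⁻¹ (≰⇒> 2≰J)))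
      hole-L-2 : ρ (L ∸ 2) ≡ false
      hole-L-2 = hole-before-L iso-L 2 (s≤s z≤n) 2≤K∸J (<-trans 1<x x<L)
      x<L-2 : x < L ∸ 2
      x<L-2 = subst (x <_) (∸-+-assoc L 1 1)
                (<∧≢-1⇒< x<L-1 (separates ρ ρx (subst (λ u → ρ u ≡ false) (sym (∸-+-assoc L 1 1)) hole-L-2)))
      L-2<L-1 : L ∸ 2 < L ∸ 1
      L-2<L-1 = subst (_< L ∸ 1) (∸-+-assoc L 1 1) (∸-monoʳ-< {L ∸ 1} {1} {0} ≤-refl (≤-trans 0<x (<⇒≤ x<L-1)))

  holes≤1 : count (suc L) hole ≤ 1
  holes≤1 = endpoints (isolated 0) (isolated L) (≤-trans holes≤isolated isolated≤endpoints) three-holes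
    where
    endpoints : ∀ {H} a b → H ≤ indicator a + indicator b → (a ≡ true → b ≡ true → 3 ≤ H) → H ≤ 1
    endpoints true  true  H≤2 3≤H = ⊥-elim (<⇒≱ (3≤H refl refl) H≤2)
    endpoints true  false H≤1 _   = H≤1
    endpoints false b     H≤b _   = ≤-trans H≤b (indicator≤1 b)

  ρ≤L : ∀ u → u < n → ρ u ≡ true → u ≤ L
  ρ≤L u u<n ρu with u ≤? L
  ... | yes u≤L = u≤L
  ... | no  u≰L = ⊥-elim (true≢false ρu (beyond-L u (≰⇒> u≰L) u<n))

  shape : IsInitialSegment ρ ⊎ IsPuncturedSegment ρ
  shape with count (suc L) hole ≤? 0
  ... | yes no-hole = inj₁ (L , L<n , ρ≤L , filled)
    where
    filled : ∀ u → u ≤ L → ρ u ≡ true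
    filled u u≤L with ρ u in ρu
    ... | true  = refl
    ... | false = ⊥-elim (<⇒≱ (count-≥1 (suc L) hole u (s≤s u≤L) (not-false ρu)) no-hole)
  ... | no  some-hole with count-witness (suc L) hole (≰⇒> some-hole)
  ...   | h , h≤L , hole-h = inj₂ (L , h , 0<h , h<L , L<n , (λ u u<n ρu → ρ≤L u u<n ρu , separates ρ ρu ρh) , filled)
    where
    ρh = not-true hole-h
    0<h : 0 < h
    0<h = n≢0⇒n>0 (separates ρ ρ0 ρh ∘ sym)
    h<L : h < L
    h<L = ≤∧≢⇒< (s≤s⁻¹ h≤L) (separates ρ ρL ρh ∘ sym)
    filled : ∀ u → u ≤ L → u ≢ h → ρ u ≡ true
    filled u u≤L u≢h with ρ u in ρu
    ... | true  = refl
    ... | false = ⊥-elim (<⇒≱ (count-≥2 (suc L) hole u h (s≤s u≤L) h≤L u≢h (not-false ρu) hole-h) holes≤1)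

-- With D = K − J: the s isolated points have J holes after and D holes before them, pairwise
-- disjoint, among G holes.
forced-parameters : ∀ J D s G → 1 ≤ J → 1 ≤ D → 3 ≤ J + D → J * s ≤ G → D * s ≤ G →
  G ≤ J + D + s → J + D + 4 ≤ G → J ≡ 2 × D ≡ 2 × s ≡ 4 × G ≡ 8
forced-parameters (suc a) (suc b) s G _ _ 3≤K Js≤G Ds≤G G≤K+s K+4≤G
  with a≡1∧b≡1 a b (a+b≤2 a b a*4≤ b*4≤) (s≤s⁻¹ (s≤s⁻¹ (≤-trans 3≤K (≤-reflexive K≡2+a+b)))) a*4≤ b*4≤
  where
  K = suc a + suc b
  K≡2+a+b : K ≡ 2 + a + b
  K≡2+a+b = cong suc (+-suc a b)
  4≤s : 4 ≤ s
  4≤s = +-cancelˡ-≤ K 4 s (≤-trans K+4≤G G≤K+s)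
  bound : ∀ c → suc c * s ≤ G → c * 4 ≤ 2 + a + b
  bound c cs≤G = begin
    c * 4    ≤⟨ *-monoʳ-≤ c 4≤s ⟩
    c * s    ≤⟨ +-cancelˡ-≤ s (c * s) K (≤-trans cs≤G (≤-trans G≤K+s (≤-reflexive (+-comm K s)))) ⟩
    K        ≡⟨ K≡2+a+b ⟩
    2 + a + b ∎
    where open ≤-Reasoning
  a*4≤ = bound a Js≤G
  b*4≤ = bound b Ds≤G
  a+b≤2 : ∀ a b → a * 4 ≤ 2 + a + b → b * 4 ≤ 2 + a + b → a + b ≤ 2
  a+b≤2 a b a*4≤ b*4≤ = *-cancelʳ-≤ (a + b) 2 2 (+-cancelˡ-≤ ((a + b) * 2) _ _ (begin
    (a + b) * 2 + (a + b) * 2    ≡⟨ double a b ⟩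
    a * 4 + b * 4                ≤⟨ +-mono-≤ a*4≤ b*4≤ ⟩
    (2 + a + b) + (2 + a + b)    ≡⟨ regroup a b ⟩
    (a + b) * 2 + 2 * 2          ∎))
    where
    open ≤-Reasoning
    double : ∀ a b → (a + b) * 2 + (a + b) * 2 ≡ a * 4 + b * 4
    double = solve-∀
    regroup : ∀ a b → (2 + a + b) + (2 + a + b) ≡ (a + b) * 2 + 2 * 2
    regroup = solve-∀
  a≡1∧b≡1 : ∀ a b → a + b ≤ 2 → 1 ≤ a + b → a * 4 ≤ 2 + a + b → b * 4 ≤ 2 + a + b → a ≡ 1 × b ≡ 1
  a≡1∧b≡1 0 0 _ () _ _
  a≡1∧b≡1 1 1 _ _ _ _ = refl , refl
  a≡1∧b≡1 0 1 _ _ _ b*4≤ = ⊥-elim (≤⇒≤ᵇ b*4≤)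
  a≡1∧b≡1 0 2 _ _ _ b*4≤ = ⊥-elim (≤⇒≤ᵇ b*4≤)
  a≡1∧b≡1 1 0 _ _ a*4≤ _ = ⊥-elim (≤⇒≤ᵇ a*4≤)
  a≡1∧b≡1 2 0 _ _ a*4≤ _ = ⊥-elim (≤⇒≤ᵇ a*4≤)
  a≡1∧b≡1 0 (suc (suc (suc b))) (s≤s (s≤s ())) _ _ _
  a≡1∧b≡1 1 (suc (suc b)) (s≤s (s≤s ())) _ _ _
  a≡1∧b≡1 2 (suc b) (s≤s (s≤s ())) _ _ _
  a≡1∧b≡1 (suc (suc (suc a))) b (s≤s (s≤s ())) _ _ _
... | refl , refl = refl , refl , s≡4 , G≡8
  where
  4≤s : 4 ≤ s
  4≤s = +-cancelˡ-≤ 4 4 s (≤-trans K+4≤G G≤K+s)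
  s≤4 : s ≤ 4
  s≤4 = +-cancelˡ-≤ s s 4 (≤-trans (≤-reflexive (cong (s +_) (sym (+-identityʳ s))))
          (≤-trans Js≤G (≤-trans G≤K+s (≤-reflexive (+-comm 4 s)))))
  s≡4 = ≤-antisym s≤4 4≤s
  G≡8 : G ≡ 8
  G≡8 = ≤-antisym (≤-trans G≤K+s (≤-reflexive (cong (4 +_) s≡4))) K+4≤G

module NoGapCase (n : ℕ) .{{_ : NonZero n}} (K J : ℕ) (ρ : ℕ → Bool) (ρ-periodic : Periodic n ρ)
  (J≥1 : 1 ≤ J) (J<K : J < K) (K≥3 : 3 ≤ K) (K<n : K < n)
  (successor : ∀ t → ρ t ≡ true → ∃ λ d → 1 ≤ d × d ≤ K × ρ (t + d) ≡ true)
  (few-bad : count n (Sumset.bad n K J ρ) ≤ K) (three : 3 ≤ count n ρ) (large : K + count n ρ + 4 ≤ n) where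

  open Congruence n
  open Periodicity n using (count-translate; count-≡⇒⊇)
  open Shapes n
  open Sumset n K J ρ
  open Properties ρ-periodic

  K≤n : K ≤ n
  K≤n = <⇒≤ K<n

  J≤n : J ≤ n
  J≤n = ≤-trans (<⇒≤ J<K) K≤n

  1≤n : 1 ≤ n
  1≤n = ≤-trans (s≤s z≤n) K<n

  2≤n : 2 ≤ n
  2≤n = ≤-trans (≤-trans (s≤s (s≤s z≤n)) K≥3) K≤n

  some-element : ∃ λ x → x < n × ρ x ≡ true
  some-element = count-witness n ρ (≤-trans (s≤s z≤n) three)

  hole-everywhere : ∀ w → ρ w ≡ false → bad w ≡ true ⊎ isolated (w + (n ∸ J)) ≡ true
  hole-everywhere w ρw with some-element
  ... | x , x<n , ρx = hole-covered J<K K<n w d d≤n ρw (trans (ρ-periodic w-d≈x) ρx)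
                         (λ i _ _ → successor (w + (n ∸ i)))
    where
    d = (w + (n ∸ x)) % n
    d≤n = <⇒≤ (m%n<n (w + (n ∸ x)) n)
    x+d≈w : x + d ≈ w
    x+d≈w = begin
      x + d                  ≈⟨ ≈-+ (≈-refl {x}) (≈-% (w + (n ∸ x))) ⟩
      x + (w + (n ∸ x))      ≡⟨ trans (sym (+-assoc x w _)) (trans (cong (_+ (n ∸ x)) (+-comm x w)) (+-assoc w x _)) ⟩
      w + (x + (n ∸ x))      ≡⟨ cong (w +_) (m+[n∸m]≡n (<⇒≤ x<n)) ⟩
      w + n                  ≈⟨ ≈-n w ⟩
      w                      ∎
      where open ≈-Reasoning
    w-d≈x : w + (n ∸ d) ≈ x
    w-d≈x = ≈-via d ([w+[n∸i]]+i≈w w d d≤n) x+d≈w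

  count-isolated-shift : ∀ c → count n (λ u → isolated (u + c)) ≡ count n isolated
  count-isolated-shift c = trans (count-cong n (λ u _ → cong isolated (+-comm u c)))
                                 (count-translate isolated isolated-periodic c)

  holes≤K+isolated : count n hole ≤ K + count n isolated
  holes≤K+isolated = begin
    count n hole
      ≤⟨ count-mono n (λ w _ hole-w → covered w (not-true hole-w)) ⟩
    count n (λ w → bad w ∨ isolated (w + (n ∸ J)))
      ≤⟨ count-∨-≤ n bad (λ w → isolated (w + (n ∸ J))) ⟩
    count n bad + count n (λ w → isolated (w + (n ∸ J)))
      ≤⟨ +-mono-≤ few-bad (≤-reflexive (count-isolated-shift (n ∸ J))) ⟩
    K + count n isolated ∎
    where
    open ≤-Reasoning
    covered : ∀ w → ρ w ≡ false → bad w ∨ isolated (w + (n ∸ J)) ≡ true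
    covered w ρw with hole-everywhere w ρw
    ... | inj₁ bad-w = cong (_∨ isolated (w + (n ∸ J))) bad-w
    ... | inj₂ iso   = ∨-introʳ (bad w) iso

  K+4≤holes : K + 4 ≤ count n hole
  K+4≤holes = +-cancelʳ-≤ (count n ρ) (K + 4) (count n hole) (begin
    K + 4 + count n ρ          ≡⟨ trans (+-assoc K 4 _) (trans (cong (K +_) (+-comm 4 _)) (sym (+-assoc K _ 4))) ⟩
    K + count n ρ + 4          ≤⟨ large ⟩
    n                          ≡⟨ count-ρ+hole ⟨
    count n ρ + count n hole   ≡⟨ +-comm (count n ρ) _ ⟩
    count n hole + count n ρ   ∎)
    where open ≤-Reasoning

  near-isolated-after : ℕ → ℕ → Bool
  near-isolated-after m w = anyBelow m (λ e → isolated (w + (n ∸ suc e)))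

  near-isolated-before : ℕ → ℕ → Bool
  near-isolated-before m w = anyBelow m (λ e → isolated (w + suc e))

  near-isolated-after-periodic : ∀ m → Periodic n (near-isolated-after m)
  near-isolated-after-periodic m a≈b = anyBelow-cong m (λ e _ → isolated-periodic (≈-+ a≈b ≈-refl))

  near-isolated-before-periodic : ∀ m → Periodic n (near-isolated-before m)
  near-isolated-before-periodic m a≈b = anyBelow-cong m (λ e _ → isolated-periodic (≈-+ a≈b ≈-refl))

  near-isolated-after⇒hole : ∀ m → m ≤ J → ∀ w → near-isolated-after m w ≡ true → hole w ≡ true
  near-isolated-after⇒hole m m≤J w near with anyBelow-elim m _ near
  ... | e , e<m , iso = not-false (trans (ρ-periodic (≈-sym ([w+[n∸i]]+i≈w w (suc e) (≤-trans e<m (≤-trans m≤J J≤n)))))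
                                         (isolated-after _ iso (suc e) (s≤s z≤n) (≤-trans e<m m≤J)))

  near-isolated-before⇒hole : ∀ m → m ≤ K ∸ J → ∀ w → near-isolated-before m w ≡ true → hole w ≡ true
  near-isolated-before⇒hole m m≤K∸J w near with anyBelow-elim m _ near
  ... | e , e<m , iso = not-false (trans (ρ-periodic (≈-sym ([w+i]+[n∸i]≈w w (suc e) e+1≤n)))
                                         (isolated-before _ iso (suc e) (s≤s z≤n) (≤-trans e<m m≤K∸J)))
    where
    e+1≤n = ≤-trans (≤-trans e<m m≤K∸J) (≤-trans (m∸n≤m K J) K≤n)

  count-near-isolated-after : ∀ m → m ≤ J → count n (near-isolated-after m) ≡ m * count n isolated
  count-near-isolated-after zero    _     = count-false n (λ _ _ → refl)
  count-near-isolated-after (suc m) m+1≤J = begin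
    count n (λ w → near-isolated-after m w ∨ isolated (w + (n ∸ suc m)))
      ≡⟨ count-∨-disjoint n (near-isolated-after m) _ (λ w _ → disjoint w) ⟩
    count n (near-isolated-after m) + count n (λ w → isolated (w + (n ∸ suc m)))
      ≡⟨ cong₂ _+_ (count-near-isolated-after m (≤-trans (n≤1+n m) m+1≤J)) (count-isolated-shift (n ∸ suc m)) ⟩
    m * count n isolated + count n isolated
      ≡⟨ +-comm (m * count n isolated) _ ⟩
    suc m * count n isolated ∎
    where
    open ≡-Reasoning
    disjoint : ∀ w → near-isolated-after m w ≡ true → isolated (w + (n ∸ suc m)) ≡ true → ⊥
    disjoint w near iso with anyBelow-elim m _ near
    ... | e , e<m , iso-e = true≢false (isolated⇒ρ _ iso-e)
          (trans (sym (ρ-periodic t+d≈w-e)) (isolated-after _ iso (m ∸ e) (m<n⇒0<n∸m e<m) d≤J))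
      where
      d≤J : m ∸ e ≤ J
      d≤J = ≤-trans (m∸n≤m m e) (≤-trans (n≤1+n m) m+1≤J)
      t+d≈w-e : w + (n ∸ suc m) + (m ∸ e) ≈ w + (n ∸ suc e)
      t+d≈w-e = subst (λ k → w + (n ∸ suc m) + (m ∸ e) ≈ w + (n ∸ k))
                  (trans (+-∸-assoc 1 (m∸n≤m m e)) (cong suc (m∸[m∸n]≡n (<⇒≤ e<m))))
                  ([w+[n∸i]]+d≈w+[n∸[i∸d]] w (suc m) (m ∸ e) (≤-trans (m∸n≤m m e) (n≤1+n m)) (≤-trans m+1≤J J≤n))

  count-near-isolated-before : ∀ m → m ≤ K ∸ J → count n (near-isolated-before m) ≡ m * count n isolated
  count-near-isolated-before zero    _       = count-false n (λ _ _ → refl)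
  count-near-isolated-before (suc m) m+1≤K∸J = begin
    count n (λ w → near-isolated-before m w ∨ isolated (w + suc m))
      ≡⟨ count-∨-disjoint n (near-isolated-before m) _ (λ w _ → disjoint w) ⟩
    count n (near-isolated-before m) + count n (λ w → isolated (w + suc m))
      ≡⟨ cong₂ _+_ (count-near-isolated-before m (≤-trans (n≤1+n m) m+1≤K∸J)) (count-isolated-shift (suc m)) ⟩
    m * count n isolated + count n isolated
      ≡⟨ +-comm (m * count n isolated) _ ⟩
    suc m * count n isolated ∎
    where
    open ≡-Reasoning
    disjoint : ∀ w → near-isolated-before m w ≡ true → isolated (w + suc m) ≡ true → ⊥
    disjoint w near iso with anyBelow-elim m _ near
    ... | e , e<m , iso-e = true≢false (isolated⇒ρ _ iso-e)
          (trans (sym (ρ-periodic t-d≈w+e)) (isolated-before _ iso (m ∸ e) (m<n⇒0<n∸m e<m) d≤K∸J))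
      where
      d≤K∸J : m ∸ e ≤ K ∸ J
      d≤K∸J = ≤-trans (m∸n≤m m e) (≤-trans (n≤1+n m) m+1≤K∸J)
      t-d≈w+e : w + suc m + (n ∸ (m ∸ e)) ≈ w + suc e
      t-d≈w+e = ≈-via (m ∸ e) ([w+[n∸i]]+i≈w (w + suc m) (m ∸ e) (≤-trans d≤K∸J (≤-trans (m∸n≤m K J) K≤n)))
                  (≈-reflexive (trans (+-assoc w (suc e) (m ∸ e)) (cong (λ k → w + suc k) (m+[n∸m]≡n (<⇒≤ e<m)))))

  parameters : J ≡ 2 × K ∸ J ≡ 2 × count n isolated ≡ 4 × count n hole ≡ 8
  parameters = forced-parameters J (K ∸ J) (count n isolated) (count n hole) J≥1 (m<n⇒0<n∸m J<K)
    (subst (3 ≤_) (sym J+[K∸J]≡K) K≥3)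
    (subst (_≤ count n hole) (count-near-isolated-after J ≤-refl) (count-mono n (λ w _ → near-isolated-after⇒hole J ≤-refl w)))
    (subst (_≤ count n hole) (count-near-isolated-before (K ∸ J) ≤-refl) (count-mono n (λ w _ → near-isolated-before⇒hole (K ∸ J) ≤-refl w)))
    (subst (λ k → count n hole ≤ k + count n isolated) (sym J+[K∸J]≡K) holes≤K+isolated)
    (subst (λ k → k + 4 ≤ count n hole) (sym J+[K∸J]≡K) K+4≤holes)
    where
    J+[K∸J]≡K : J + (K ∸ J) ≡ K
    J+[K∸J]≡K = m+[n∸m]≡n (<⇒≤ J<K)

  J≡2 : J ≡ 2
  J≡2 with parameters
  ... | J≡2 , _ = J≡2

  K∸J≡2 : K ∸ J ≡ 2
  K∸J≡2 with parameters
  ... | _ , K∸J≡2 , _ = K∸J≡2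

  isolated≡4 : count n isolated ≡ 4
  isolated≡4 with parameters
  ... | _ , _ , s≡4 , _ = s≡4

  holes≡8 : count n hole ≡ 8
  holes≡8 with parameters
  ... | _ , _ , _ , G≡8 = G≡8

  -- Both families of neighbours already have as many elements as there are holes.
  hole⇒near-isolated-after : ∀ w → ρ w ≡ false → near-isolated-after 2 w ≡ true
  hole⇒near-isolated-after w ρw = count-≡⇒⊇ (near-isolated-after 2) hole (near-isolated-after-periodic 2) hole-periodic
    (near-isolated-after⇒hole 2 (≤-reflexive (sym J≡2)))
    (trans (count-near-isolated-after 2 (≤-reflexive (sym J≡2))) (trans (cong (2 *_) isolated≡4) (sym holes≡8)))
    w (not-false ρw)

  hole⇒near-isolated-before : ∀ w → ρ w ≡ false → near-isolated-before 2 w ≡ true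
  hole⇒near-isolated-before w ρw = count-≡⇒⊇ (near-isolated-before 2) hole (near-isolated-before-periodic 2) hole-periodic
    (near-isolated-before⇒hole 2 (≤-reflexive (sym K∸J≡2)))
    (trans (count-near-isolated-before 2 (≤-reflexive (sym K∸J≡2))) (trans (cong (2 *_) isolated≡4) (sym holes≡8)))
    w (not-false ρw)

  NonIsolatedElement : ℕ → Set
  NonIsolatedElement y = ρ y ≡ true × isolated y ≡ false

  predecessor : ∀ y → ρ y ≡ true → isolated y ≡ false → NonIsolatedElement (y + (n ∸ 1))
  predecessor y ρy not-iso = ρ-pred , not-iso-pred
    where
    y′ = y + (n ∸ 1)
    y′+1≈y : y′ + 1 ≈ y
    y′+1≈y = [w+[n∸i]]+i≈w y 1 1≤n
    y′+2-1≈y : y′ + 2 + (n ∸ 1) ≈ y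
    y′+2-1≈y = ≈-trans (≈-reflexive (cong (_+ (n ∸ 1)) (sym (+-assoc y′ 1 1))))
                       (≈-trans ([w+i]+[n∸i]≈w (y′ + 1) 1 1≤n) y′+1≈y)
    excluded : (∃ λ e → e < 2 × isolated (y′ + suc e) ≡ true) → ⊥
    excluded (0 , _ , iso) = true≢false (trans (sym (isolated-periodic y′+1≈y)) iso) not-iso
    excluded (1 , _ , iso) = true≢false ρy (trans (ρ-periodic (≈-sym y′+2-1≈y))
                               (isolated-before (y′ + 2) iso 1 ≤-refl (m<n⇒0<n∸m J<K)))
    excluded (suc (suc _) , s≤s (s≤s ()) , _)
    ρ-pred : ρ y′ ≡ true
    ρ-pred = ¬false⇒true λ ρy′ → excluded (anyBelow-elim 2 (λ e → isolated (y′ + suc e)) (hole⇒near-isolated-before y′ ρy′))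
    not-iso-pred : isolated y′ ≡ false
    not-iso-pred = ¬true⇒false λ iso → true≢false ρy (trans (ρ-periodic (≈-sym y′+1≈y)) (isolated-after y′ iso 1 ≤-refl J≥1))

  descent : ∀ y → ρ y ≡ true → isolated y ≡ false → ∀ i → NonIsolatedElement (y + i * (n ∸ 1))
  descent y ρy not-iso zero    = subst NonIsolatedElement (sym (+-identityʳ y)) (ρy , not-iso)
  descent y ρy not-iso (suc i) = subst NonIsolatedElement (regroup y i (n ∸ 1))
    (predecessor (y + i * (n ∸ 1)) (proj₁ (descent y ρy not-iso i)) (proj₂ (descent y ρy not-iso i)))
    where
    regroup : ∀ y i m → y + i * m + m ≡ y + (m + i * m)
    regroup = solve-∀

  all-isolated : ∀ x → ρ x ≡ true → isolated x ≡ true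
  all-isolated x ρx = ¬false⇒true λ not-iso → true≢false
    (trans (sym (ρ-periodic reaches-h)) (proj₁ (descent x ρx not-iso i))) (not-true hole-h)
    where
    some-hole = count-witness n hole (subst (1 ≤_) (sym holes≡8) (s≤s z≤n))
    h = proj₁ some-hole
    h<n = proj₁ (proj₂ some-hole)
    hole-h = proj₂ (proj₂ some-hole)
    i = x + (n ∸ h)
    reaches-h : x + i * (n ∸ 1) ≈ h
    reaches-h = ≈-via i
      (begin
        x + i * (n ∸ 1) + i      ≡⟨ collect x i (n ∸ 1) ⟩
        x + i * (n ∸ 1 + 1)      ≡⟨ cong (λ k → x + i * k) (m∸n+n≡m 1≤n) ⟩
        x + i * n                ≈⟨ ≈-kn x i ⟩
        x                        ∎)
      (begin
        h + (x + (n ∸ h))        ≡⟨ trans (sym (+-assoc h x _)) (trans (cong (_+ (n ∸ h)) (+-comm h x)) (+-assoc x h _)) ⟩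
        x + (h + (n ∸ h))        ≡⟨ cong (x +_) (m+[n∸m]≡n (<⇒≤ h<n)) ⟩
        x + n                    ≈⟨ ≈-n x ⟩
        x                        ∎)
      where
      open ≈-Reasoning
      collect : ∀ x i m → x + i * m + i ≡ x + i * (m + 1)
      collect = solve-∀

  x+[d+i]+[n∸i]≈x+d : ∀ x d i → i ≤ n → x + (d + i) + (n ∸ i) ≈ x + d
  x+[d+i]+[n∸i]≈x+d x d i i≤n =
    ≈-trans (≈-reflexive (cong (_+ (n ∸ i)) (sym (+-assoc x d i)))) ([w+i]+[n∸i]≈w (x + d) i i≤n)

  isolated+3 : ∀ x → isolated x ≡ true → ρ (x + 3) ≡ true
  isolated+3 x iso = ¬false⇒true λ ρx+3 →
    excluded (anyBelow-elim 2 (λ e → isolated (x + 3 + (n ∸ suc e))) (hole⇒near-isolated-after (x + 3) ρx+3))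
    where
    excluded : (∃ λ e → e < 2 × isolated (x + 3 + (n ∸ suc e)) ≡ true) → ⊥
    excluded (0 , _ , iso′) = true≢false (isolated⇒ρ _ iso′)
      (trans (ρ-periodic (x+[d+i]+[n∸i]≈x+d x 2 1 1≤n)) (isolated-after x iso 2 (s≤s z≤n) (≤-reflexive (sym J≡2))))
    excluded (1 , _ , iso′) = true≢false (isolated⇒ρ _ iso′)
      (trans (ρ-periodic (x+[d+i]+[n∸i]≈x+d x 1 2 2≤n)) (isolated-after x iso 1 ≤-refl J≥1))
    excluded (suc (suc _) , s≤s (s≤s ()) , _)

  n≡12 : n ≡ 12
  n≡12 = begin
    n                              ≡⟨ count-ρ+hole ⟨
    count n ρ + count n hole       ≡⟨ cong₂ _+_ (trans ρ≡isolated isolated≡4) holes≡8 ⟩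
    12                             ∎
    where
    open ≡-Reasoning
    ρ≡isolated : count n ρ ≡ count n isolated
    ρ≡isolated = ≤-antisym (count-mono n (λ u _ → all-isolated u)) (count-mono n (λ u _ → isolated⇒ρ u))

  module _ (x : ℕ) (ρx : ρ x ≡ true) where

    ρ-on-multiples : ∀ q → ρ (x + q * 3) ≡ true
    ρ-on-multiples zero    = subst (λ z → ρ z ≡ true) (sym (+-identityʳ x)) ρx
    ρ-on-multiples (suc q) = subst (λ z → ρ z ≡ true) (regroup x q) (isolated+3 _ (all-isolated _ (ρ-on-multiples q)))
      where
      regroup : ∀ x q → x + q * 3 + 3 ≡ x + (3 + q * 3)
      regroup = solve-∀

    ρ-only-multiples : ∀ u → ρ (x + u) ≡ true → u % 3 ≡ 0
    ρ-only-multiples u ρx+u = residue (u % 3) (m%n<n u 3) (m≡m%n+[m/n]*n u 3)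
      where
      q = u / 3
      on-q = all-isolated _ (ρ-on-multiples q)
      shifted : ∀ r → u ≡ r + q * 3 → x + u ≡ x + q * 3 + r
      shifted r u≡ = trans (cong (x +_) (trans u≡ (+-comm r (q * 3)))) (sym (+-assoc x (q * 3) r))
      residue : ∀ r → r < 3 → u ≡ r + q * 3 → r ≡ 0
      residue 0 _ _ = refl
      residue 1 _ u≡ = ⊥-elim (true≢false (trans (cong ρ (sym (shifted 1 u≡))) ρx+u)
                                          (isolated-after _ on-q 1 ≤-refl J≥1))
      residue 2 _ u≡ = ⊥-elim (true≢false (trans (cong ρ (sym (shifted 2 u≡))) ρx+u)
                                          (isolated-after _ on-q 2 (s≤s z≤n) (≤-reflexive (sym J≡2))))
      residue (suc (suc (suc _))) (s≤s (s≤s (s≤s ()))) _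

  shape : n ≡ 12 × Σ ℕ λ b → IsMultiplesOf3 (λ u → ρ (b + u))
  shape with some-element
  ... | x , _ , ρx = n≡12 , x , ρ-only-multiples x ρx ,
                     λ u u%3≡0 → subst (λ v → ρ (x + v) ≡ true)
                                   (sym (trans (m≡m%n+[m/n]*n u 3) (cong (_+ (u / 3) * 3) u%3≡0)))
                                   (ρ-on-multiples x ρx (u / 3))

module Structure (n : ℕ) .{{_ : NonZero n}} (K J : ℕ) (ρ : ℕ → Bool) (ρ-periodic : Periodic n ρ)
  (J≥1 : 1 ≤ J) (J<K : J < K) (K≥3 : 3 ≤ K) (three : 3 ≤ count n ρ) (large : K + count n ρ + 4 ≤ n)
  (small-sumset : count n (λ w → ρ w ∨ Sumset.ρ+D n K J ρ w) ≤ K + count n ρ) where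

  open Congruence n
  open Periodicity n using (count-translate)
  open Shapes n
  open Sumset n K J ρ
  open Properties ρ-periodic

  K<n : K < n
  K<n = begin-strict
    K                     ≤⟨ m≤m+n K (count n ρ) ⟩
    K + count n ρ         <⟨ m<m+n (K + count n ρ) (s≤s z≤n) ⟩
    K + count n ρ + 4     ≤⟨ large ⟩
    n                     ∎
    where open ≤-Reasoning

  few-bad : count n bad ≤ K
  few-bad = +-cancelˡ-≤ (count n ρ) (count n bad) K (begin
    count n ρ + count n bad             ≡⟨ count-ρ∪ρ+D ⟨
    count n (λ w → ρ w ∨ ρ+D w)         ≤⟨ small-sumset ⟩
    K + count n ρ                       ≡⟨ +-comm K _ ⟩
    count n ρ + K                       ∎)
    where open ≤-Reasoning

  Gap : ℕ → Set
  Gap t = ρ t ≡ true × (∀ d → 1 ≤ d → d ≤ K → ρ (t + d) ≡ false)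

  gap-or-successors : (∃ λ t → Gap t) ⊎ (∀ t → ρ t ≡ true → ∃ λ d → 1 ≤ d × d ≤ K × ρ (t + d) ≡ true)
  gap-or-successors with anyBelow n (λ t → ρ t ∧ not (anyBelow K (λ e → ρ (t + suc e)))) in gap
  ... | true with anyBelow-elim n _ gap
  ...   | t , _ , ρt∧none = inj₁ (t , ∧-conicalˡ (ρ t) _ ρt∧none , λ { (suc e) _ d≤K →
                              anyBelow-false K _ (not-true (∧-conicalʳ (ρ t) _ ρt∧none)) e d≤K })
  gap-or-successors | false = inj₂ successor
    where
    successor : ∀ t → ρ t ≡ true → ∃ λ d → 1 ≤ d × d ≤ K × ρ (t + d) ≡ true
    successor t ρt with anyBelow K (λ e → ρ (t % n + suc e)) in some
    ... | true with anyBelow-elim K _ some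
    ...   | e , e<K , ρt+d = suc e , s≤s z≤n , e<K , trans (sym (ρ-+-cong (suc e) (≈-% t))) ρt+d
    successor t ρt | false = ⊥-elim (true≢false entry (anyBelow-false n _ gap (t % n) (m%n<n t n)))
      where
      entry : ρ (t % n) ∧ not (anyBelow K (λ e → ρ (t % n + suc e))) ≡ true
      entry = cong₂ _∧_ (trans (ρ-periodic (≈-% t)) ρt) (not-false some)

  -- Translating the first element of ρ after the gap to 0 puts the gap at the end of the period.
  module Rotation (t : ℕ) (ρt : ρ t ≡ true) (gap : ∀ d → 1 ≤ d → d ≤ K → ρ (t + d) ≡ false) where

    M : ℕ
    M = n ∸ suc K

    ρ-at-M : ρ (t + (suc K + M)) ≡ true
    ρ-at-M = trans (cong (λ k → ρ (t + k)) (m+[n∸m]≡n K<n)) (trans (ρ-periodic (≈-n t)) ρt)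

    first-after-gap : ∃ λ f → f ≤ M × IsLeast (λ f → ρ (t + (suc K + f))) f
    first-after-gap = least-witness (λ f → ρ (t + (suc K + f))) M ρ-at-M

    f : ℕ
    f = proj₁ first-after-gap

    b : ℕ
    b = t + (suc K + f)

    L : ℕ
    L = M ∸ f

    K+f+L≡n : suc K + (f + L) ≡ n
    K+f+L≡n = trans (cong (suc K +_) (m+[n∸m]≡n (proj₁ (proj₂ first-after-gap)))) (m+[n∸m]≡n K<n)

    b+L+v≈t+v : ∀ v → b + (L + v) ≈ t + v
    b+L+v≈t+v v = begin
      t + (suc K + f) + (L + v)    ≡⟨ regroup t K f L v ⟩
      t + v + suc (K + (f + L))    ≡⟨ cong (t + v +_) K+f+L≡n ⟩
      t + v + n                    ≈⟨ ≈-n (t + v) ⟩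
      t + v                        ∎
      where
      open ≈-Reasoning
      regroup : ∀ t K f L v → t + (suc K + f) + (L + v) ≡ t + v + suc (K + (f + L))
      regroup = solve-∀

    ρb : ρ (b + 0) ≡ true
    ρb = trans (cong ρ (+-identityʳ b)) (proj₁ (proj₂ (proj₂ first-after-gap)))

    ρb+L : ρ (b + L) ≡ true
    ρb+L = trans (cong (λ k → ρ (b + k)) (sym (+-identityʳ L)))
                 (trans (ρ-periodic (b+L+v≈t+v 0)) (trans (cong ρ (+-identityʳ t)) ρt))

    L+K<n : L + K < n
    L+K<n = begin-strict
      L + K           <⟨ +-monoʳ-< L ≤-refl ⟩
      L + suc K       ≤⟨ +-monoˡ-≤ (suc K) (m≤n+m L f) ⟩
      f + L + suc K   ≡⟨ +-comm (f + L) (suc K) ⟩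
      suc K + (f + L) ≡⟨ K+f+L≡n ⟩
      n               ∎
      where open ≤-Reasoning

    ρ-in-gap : ∀ v → 1 ≤ v → v < suc K + f → ρ (t + v) ≡ false
    ρ-in-gap v 1≤v v<K+f with v ≤? K
    ... | yes v≤K = gap v 1≤v v≤K
    ... | no  v≰K = trans (cong (λ k → ρ (t + k)) (sym (m+[n∸m]≡n (≰⇒> v≰K))))
                          (proj₂ (proj₂ (proj₂ first-after-gap)) (v ∸ suc K)
                            (+-cancelˡ-< (suc K) (v ∸ suc K) f (subst (_< suc K + f) (sym (m+[n∸m]≡n (≰⇒> v≰K))) v<K+f)))

    beyond-L : ∀ u → L < u → u < n → ρ (b + u) ≡ false
    beyond-L u L<u u<n = trans (cong (λ k → ρ (b + k)) (sym L+v≡u))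
                               (trans (ρ-periodic (b+L+v≈t+v v)) (ρ-in-gap v (m<n⇒0<n∸m L<u) v<K+f))
      where
      open ≤-Reasoning
      v = u ∸ L
      L+v≡u : L + v ≡ u
      L+v≡u = m+[n∸m]≡n (<⇒≤ L<u)
      regroup : ∀ K f L → suc K + (f + L) ≡ L + (suc K + f)
      regroup = solve-∀
      v<K+f : v < suc K + f
      v<K+f = +-cancelˡ-< L v (suc K + f) (begin-strict
        L + v              ≡⟨ L+v≡u ⟩
        u                  <⟨ u<n ⟩
        n                  ≡⟨ K+f+L≡n ⟨
        suc K + (f + L)    ≡⟨ regroup K f L ⟩
        L + (suc K + f)    ∎)

  module Translated (b : ℕ) where

    ρ′ : ℕ → Bool
    ρ′ u = ρ (b + u)

    ρ′-periodic : Periodic n ρ′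
    ρ′-periodic a≈c = ρ-periodic (≈-+ (≈-refl {b}) a≈c)

    count-ρ′ : count n ρ′ ≡ count n ρ
    count-ρ′ = count-translate ρ ρ-periodic b

    count-bad′ : count n (Sumset.bad n K J ρ′) ≡ count n bad
    count-bad′ = trans (count-cong n (λ u _ → cong (not (ρ (b + u)) ∧_)
                         (anyBelow-cong K (λ e _ → cong (λ k → not (does (suc e ≟ J)) ∧ ρ k) (sym (+-assoc b u _))))))
                       (count-translate bad bad-periodic b)

  gap⇒segment : ∀ t → Gap t → SomeTranslate (λ σ → IsInitialSegment σ ⊎ IsPuncturedSegment σ) ρ
  gap⇒segment t (ρt , gap) =
    b , GapCase.shape n K J ρ′ ρ′-periodic J≥1 J<K K≥3 L L+K<n ρb ρb+L beyond-L
          (subst (_≤ K) (sym count-bad′) few-bad) (subst (3 ≤_) (sym count-ρ′) three)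
    where
    open Rotation t ρt gap
    open Translated b

  structure : SomeTranslate (λ σ → IsInitialSegment σ ⊎ IsPuncturedSegment σ) ρ ⊎ (n ≡ 12 × SomeTranslate IsMultiplesOf3 ρ)
  structure = by-cases gap-or-successors
    where
    by-cases : (∃ λ t → Gap t) ⊎ (∀ t → ρ t ≡ true → ∃ λ d → 1 ≤ d × d ≤ K × ρ (t + d) ≡ true) →
               SomeTranslate (λ σ → IsInitialSegment σ ⊎ IsPuncturedSegment σ) ρ ⊎ (n ≡ 12 × SomeTranslate IsMultiplesOf3 ρ)
    by-cases (inj₁ (t , gap)) = inj₁ (gap⇒segment t gap)
    by-cases (inj₂ successor) = inj₂ (NoGapCase.shape n K J ρ ρ-periodic J≥1 J<K K≥3 K<n successor few-bad three large)

lookupℕ : ∀ {m} → Vec Bool m → ℕ → Bool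
lookupℕ []       _       = false
lookupℕ (b ∷ bs) zero    = b
lookupℕ (b ∷ bs) (suc u) = lookupℕ bs u

lookupℕ-toℕ : ∀ {m} (bs : Vec Bool m) (x : Fin m) → lookupℕ bs (toℕ x) ≡ lookup bs x
lookupℕ-toℕ (b ∷ bs) fzero    = refl
lookupℕ-toℕ (b ∷ bs) (fsuc x) = lookupℕ-toℕ bs x

∣p∣≡count : ∀ {m} (p : Subset m) → ∣ p ∣ ≡ count m (lookupℕ p)
∣p∣≡count []          = refl
∣p∣≡count (true ∷ p)  = cong suc (∣p∣≡count p)
∣p∣≡count (false ∷ p) = ∣p∣≡count p

does-true : ∀ {A : Set} (a? : Dec A) → does a? ≡ true → A
does-true (yes a) _ = a

module Subsets (n : ℕ) .{{_ : NonZero n}} where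
  open Congruence n

  member : Subset n → ℕ → Bool
  member X u = lookup X (ι u)

  member-periodic : ∀ X → Periodic n (member X)
  member-periodic X a≈b = cong (lookup X) (ι-cong a≈b)

  member⇒∈ : ∀ X u → member X u ≡ true → ι u ∈ X
  member⇒∈ X u = lookup⇒[]= (ι u) X

  ∈⇒member : ∀ X u → ι u ∈ X → member X u ≡ true
  ∈⇒member X u = []=⇒lookup

  ∣X∣≡count-member : ∀ X → ∣ X ∣ ≡ count n (member X)
  ∣X∣≡count-member X = trans (∣p∣≡count X) (count-cong n (λ u u<n → begin
    lookupℕ X u              ≡⟨ cong (lookupℕ X) (trans (sym (m<n⇒m%n≡m u<n)) (sym (toℕ-ι u))) ⟩
    lookupℕ X (toℕ (ι u))    ≡⟨ lookupℕ-toℕ X (ι u) ⟩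
    lookup X (ι u)           ∎))
    where open ≡-Reasoning

  module _ (S T : Subset n) where

    sums? : ∀ x → Dec (∃₂ λ s t → s ∈ S × t ∈ T × _⊕_ n s t ≡ x)
    sums? x = any? λ s → any? λ t → (s ∈? S) ×-dec ((t ∈? T) ×-dec (_⊕_ n s t ≟ᶠ x))

    ∈sumset⇒ : ∀ x → x ∈ sumset n S T → ∃₂ λ s t → s ∈ S × t ∈ T × _⊕_ n s t ≡ x
    ∈sumset⇒ x x∈S+T = does-true (sums? x) (trans (sym (lookup∘tabulate _ x)) ([]=⇒lookup x∈S+T))

    ∈sumset⇐ : ∀ {s t} → s ∈ S → t ∈ T → _⊕_ n s t ∈ sumset n S T
    ∈sumset⇐ {s} {t} s∈S t∈T = lookup⇒[]= (_⊕_ n s t) (sumset n S T)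
      (trans (lookup∘tabulate _ (_⊕_ n s t)) (dec-true (sums? (_⊕_ n s t)) (s , t , s∈S , t∈T , refl)))

module Progressions (n : ℕ) .{{_ : NonZero n}} (r : Fin n) where
  open Congruence n

  Injective-from : Fin n → ℕ → Set
  Injective-from a ℓ = ∀ (i j : Fin ℓ) → _⊕_ n a (_·_ n (toℕ i) r) ≡ _⊕_ n a (_·_ n (toℕ j) r) → i ≡ j

  Enumerates : Subset n → Fin n → ℕ → Set
  Enumerates X a ℓ = ∀ x → (x ∈ X → ∃ λ (i : Fin ℓ) → x ≡ _⊕_ n a (_·_ n (toℕ i) r))
                         × ((∃ λ (i : Fin ℓ) → x ≡ _⊕_ n a (_·_ n (toℕ i) r)) → x ∈ X)

  a⊕i·r≡ι : ∀ a i → _⊕_ n a (_·_ n i r) ≡ ι (toℕ a + i * toℕ r)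
  a⊕i·r≡ι a i = ι-cong (≈-+ (≈-refl {toℕ a}) (ι-≈ (i * toℕ r)))

  -- The terms with indices 0 and n coincide.
  injective⇒length≤n : ∀ a ℓ → Injective-from a ℓ → ℓ ≤ n
  injective⇒length≤n a ℓ injective with ℓ ≤? n
  ... | yes ℓ≤n = ℓ≤n
  ... | no  ℓ≰n = ⊥-elim (≢-nonZero⁻¹ n (begin
      n                       ≡⟨ toℕ-fromℕ< n<ℓ ⟨
      toℕ (fromℕ< n<ℓ)        ≡⟨ cong toℕ (injective _ _ same-term) ⟨
      toℕ (fromℕ< 0<ℓ)        ≡⟨ toℕ-fromℕ< 0<ℓ ⟩
      0                       ∎))
    where
    open ≡-Reasoning
    n<ℓ = ≰⇒> ℓ≰n
    0<ℓ = ≤-trans (s≤s z≤n) n<ℓ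
    same-term : _⊕_ n a (_·_ n (toℕ (fromℕ< 0<ℓ)) r) ≡ _⊕_ n a (_·_ n (toℕ (fromℕ< n<ℓ)) r)
    same-term = begin
      _⊕_ n a (_·_ n (toℕ (fromℕ< 0<ℓ)) r)     ≡⟨ a⊕i·r≡ι a (toℕ (fromℕ< 0<ℓ)) ⟩
      ι (toℕ a + toℕ (fromℕ< 0<ℓ) * toℕ r)    ≡⟨ cong (λ i → ι (toℕ a + i * toℕ r)) (toℕ-fromℕ< 0<ℓ) ⟩
      ι (toℕ a + 0)                           ≡⟨ ι-cong (≈-sym (≈-+ (≈-refl {toℕ a}) (≈-trans (≈-reflexive (*-comm n (toℕ r))) (≈-kn 0 (toℕ r))))) ⟩
      ι (toℕ a + n * toℕ r)                   ≡⟨ cong (λ i → ι (toℕ a + i * toℕ r)) (toℕ-fromℕ< n<ℓ) ⟨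
      ι (toℕ a + toℕ (fromℕ< n<ℓ) * toℕ r)    ≡⟨ a⊕i·r≡ι a (toℕ (fromℕ< n<ℓ)) ⟨
      _⊕_ n a (_·_ n (toℕ (fromℕ< n<ℓ)) r)     ∎

  isAP? : ∀ X → Dec (IsAP n r X)
  isAP? X with any? (λ a → any? (λ (ℓ : Fin (suc n)) → injective? a (toℕ ℓ) ×-dec enumerates? a (toℕ ℓ)))
    where
    injective? : ∀ a ℓ → Dec (Injective-from a ℓ)
    injective? a ℓ = all? λ i → all? λ j → (_⊕_ n a (_·_ n (toℕ i) r) ≟ᶠ _⊕_ n a (_·_ n (toℕ j) r)) →-dec (i ≟ᶠ j)
    enumerates? : ∀ a ℓ → Dec (Enumerates X a ℓ)
    enumerates? a ℓ = all? λ x → ((x ∈? X) →-dec any? (λ (i : Fin ℓ) → x ≟ᶠ _⊕_ n a (_·_ n (toℕ i) r)))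
                               ×-dec (any? (λ (i : Fin ℓ) → x ≟ᶠ _⊕_ n a (_·_ n (toℕ i) r)) →-dec (x ∈? X))
  ... | yes (a , ℓ , ap) = yes (a , toℕ ℓ , ap)
  ... | no ¬ap = no λ { (a , ℓ , injective , enumerates) → ¬ap (a , fromℕ< (ℓ<1+n a ℓ injective) ,
                   subst (λ k → Injective-from a k × Enumerates X a k) (sym (toℕ-fromℕ< (ℓ<1+n a ℓ injective)))
                     (injective , enumerates)) }
    where
    ℓ<1+n : ∀ a ℓ → Injective-from a ℓ → ℓ < suc n
    ℓ<1+n a ℓ injective = s≤s (injective⇒length≤n a ℓ injective)

  module UnitDifference (w : ℕ) (unit : w * toℕ r ≈ 1) where
    open Periodicity n using (affine-inverse; unit-cancel)
    open Subsets n
    open Shapes n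

    coordinate : ∀ c x → Σ ℕ λ u → u < n × c + u * toℕ r ≈ x
    coordinate c x = _ , m%n<n _ n , affine-inverse {toℕ r} {w} unit c x

    coordinate-unique : ∀ c {u v} → c + u * toℕ r ≈ c + v * toℕ r → u < n → v < n → u ≡ v
    coordinate-unique c e u<n v<n = ≈-< u<n v<n (unit-cancel {toℕ r} {w} unit (≈-cancelˡ c e))

    coordinate-∈ : ∀ X c x → x ∈ X → Σ ℕ λ u → u < n × member X (c + u * toℕ r) ≡ true × x ≡ ι (c + u * toℕ r)
    coordinate-∈ X c x x∈X with coordinate c (toℕ x)
    ... | u , u<n , c+ur≈x = u , u<n , ∈⇒member X _ (subst (_∈ X) x≡ x∈X) , x≡
      where
      x≡ : x ≡ ι (c + u * toℕ r)
      x≡ = sym (trans (ι-cong c+ur≈x) (ι-toℕ x))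

    progression⇒IsAP : ∀ X c ℓ → ℓ ≤ n → (∀ x → x ∈ X → ∃ λ i → i < ℓ × x ≡ ι (c + i * toℕ r)) →
                       (∀ i → i < ℓ → ι (c + i * toℕ r) ∈ X) → IsAP n r X
    progression⇒IsAP X c ℓ ℓ≤n ⊆progression progression⊆ = ι c , ℓ , injective , enumerates
      where
      term : ∀ i → _⊕_ n (ι c) (_·_ n i r) ≡ ι (c + i * toℕ r)
      term i = trans (a⊕i·r≡ι (ι c) i) (ι-cong (≈-+ (ι-≈ c) (≈-refl {i * toℕ r})))
      injective : Injective-from (ι c) ℓ
      injective i j e = toℕ-injective (coordinate-unique c (ι-injective (trans (sym (term (toℕ i))) (trans e (term (toℕ j)))))
                          (≤-trans (toℕ<n i) ℓ≤n) (≤-trans (toℕ<n j) ℓ≤n))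
      enumerates : Enumerates X (ι c) ℓ
      enumerates x = (λ x∈X → let (i , i<ℓ , x≡) = ⊆progression x x∈X in
                        fromℕ< i<ℓ , trans x≡ (trans (cong (λ k → ι (c + k * toℕ r)) (sym (toℕ-fromℕ< i<ℓ))) (sym (term (toℕ (fromℕ< i<ℓ))))))
                   , λ { (i , x≡) → subst (_∈ X) (sym (trans x≡ (term (toℕ i)))) (progression⊆ (toℕ i) (toℕ<n i)) }

    module _ (X : Subset n) (c : ℕ) (σ : ℕ → Bool) (σ≗X : ∀ u → σ u ≡ member X (c + u * toℕ r)) where

      initialSegment⇒IsAP : IsInitialSegment σ → IsAP n r X
      initialSegment⇒IsAP (L , L<n , σ≤L , ≤L⇒σ) = progression⇒IsAP X c (suc L) L<n ⊆segment segment⊆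
        where
        ⊆segment : ∀ x → x ∈ X → ∃ λ i → i < suc L × x ≡ ι (c + i * toℕ r)
        ⊆segment x x∈X with coordinate-∈ X c x x∈X
        ... | u , u<n , u∈ , x≡ = u , s≤s (σ≤L u u<n (trans (σ≗X u) u∈)) , x≡
        segment⊆ : ∀ i → i < suc L → ι (c + i * toℕ r) ∈ X
        segment⊆ i i≤L = member⇒∈ X _ (trans (sym (σ≗X i)) (≤L⇒σ i (s≤s⁻¹ i≤L)))

      puncturedSegment⇒ : IsPuncturedSegment σ → IsQuasiProgression n r X ⊎ IsAP n r X
      puncturedSegment⇒ (L , h , 0<h , h<L , L<n , σ⊆ , ⊆σ) with isAP? X
      ... | yes X-AP = inj₂ X-AP
      ... | no ¬X-AP = inj₁ (¬X-AP , X ∪ ⁅ z ⁆ , filled-AP , z , x∈p∪q⁺ (inj₂ (x∈⁅x⁆ z)) , λ x → deleted x , restored x)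
        where
        z = ι (c + h * toℕ r)
        h<n = <-trans h<L L<n
        coordinate-≤L : ∀ x → x ∈ X → Σ ℕ λ u → u < n × (u ≤ L × u ≢ h) × x ≡ ι (c + u * toℕ r)
        coordinate-≤L x x∈X with coordinate-∈ X c x x∈X
        ... | u , u<n , u∈ , x≡ = u , u<n , σ⊆ u u<n (trans (σ≗X u) u∈) , x≡
        filled-AP : IsAP n r (X ∪ ⁅ z ⁆)
        filled-AP = progression⇒IsAP (X ∪ ⁅ z ⁆) c (suc L) L<n ⊆segment segment⊆
          where
          ⊆segment : ∀ x → x ∈ X ∪ ⁅ z ⁆ → ∃ λ i → i < suc L × x ≡ ι (c + i * toℕ r)
          ⊆segment x x∈ with x∈p∪q⁻ X ⁅ z ⁆ x∈
          ... | inj₂ x∈⁅z⁆ = h , s≤s (<⇒≤ h<L) , x∈⁅y⁆⇒x≡y z x∈⁅z⁆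
          ... | inj₁ x∈X with coordinate-≤L x x∈X
          ...   | u , _ , (u≤L , _) , x≡ = u , s≤s u≤L , x≡
          segment⊆ : ∀ i → i < suc L → ι (c + i * toℕ r) ∈ X ∪ ⁅ z ⁆
          segment⊆ i i≤L with i ≟ h
          ... | yes refl = x∈p∪q⁺ (inj₂ (x∈⁅x⁆ z))
          ... | no  i≢h  = x∈p∪q⁺ (inj₁ (member⇒∈ X _ (trans (sym (σ≗X i)) (⊆σ i (s≤s⁻¹ i≤L) i≢h))))
        deleted : ∀ x → x ∈ X → x ∈ X ∪ ⁅ z ⁆ × x ≢ z
        deleted x x∈X with coordinate-≤L x x∈X
        ... | u , u<n , (_ , u≢h) , x≡ =
          x∈p∪q⁺ (inj₁ x∈X) , λ x≡z → u≢h (coordinate-unique c (ι-injective (trans (sym x≡) x≡z)) u<n h<n)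
        restored : ∀ x → x ∈ X ∪ ⁅ z ⁆ × x ≢ z → x ∈ X
        restored x (x∈ , x≢z) with x∈p∪q⁻ X ⁅ z ⁆ x∈
        ... | inj₁ x∈X   = x∈X
        ... | inj₂ x∈⁅z⁆ = ⊥-elim (x≢z (x∈⁅y⁆⇒x≡y z x∈⁅z⁆))

module MultiplesOf3 (n : ℕ) .{{_ : NonZero n}} (3∣n : 3 ∣ n) where
  open Congruence n
  open Subsets n
  open Shapes n

  multiple-of-3? : Fin n → Bool
  multiple-of-3? x = does (toℕ x % 3 ≟ 0)

  multiples-of-3 : Subset n
  multiples-of-3 = tabulate multiple-of-3?

  ∈multiples-of-3⇒ : ∀ x → x ∈ multiples-of-3 → toℕ x % 3 ≡ 0
  ∈multiples-of-3⇒ x x∈ = does-true (toℕ x % 3 ≟ 0) (trans (sym (lookup∘tabulate multiple-of-3? x)) ([]=⇒lookup x∈))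

  ι∈multiples-of-3 : ∀ a → a % 3 ≡ 0 → ι a ∈ multiples-of-3
  ι∈multiples-of-3 a a%3≡0 = lookup⇒[]= (ι a) multiples-of-3 (trans (lookup∘tabulate multiple-of-3? (ι a))
    (dec-true (toℕ (ι a) % 3 ≟ 0) (trans (cong (_% 3) (toℕ-ι a)) (trans (m∣n⇒o%n%m≡o%m 3 n a 3∣n) a%3≡0))))

  multiples-of-3-subgroup : IsSubgroup n multiples-of-3
  multiples-of-3-subgroup = ι∈multiples-of-3 0 refl , closed-+ , closed-⊖
    where
    closed-+ : ∀ x y → x ∈ multiples-of-3 → y ∈ multiples-of-3 → _⊕_ n x y ∈ multiples-of-3
    closed-+ x y x∈ y∈ = ι∈multiples-of-3 (toℕ x + toℕ y) (begin
      (toℕ x + toℕ y) % 3              ≡⟨ %-distribˡ-+ (toℕ x) (toℕ y) 3 ⟩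
      (toℕ x % 3 + toℕ y % 3) % 3      ≡⟨ cong₂ (λ a b → (a + b) % 3) (∈multiples-of-3⇒ x x∈) (∈multiples-of-3⇒ y y∈) ⟩
      0                                ∎)
      where open ≡-Reasoning
    closed-⊖ : ∀ x → x ∈ multiples-of-3 → ⊖_ n x ∈ multiples-of-3
    closed-⊖ x x∈ = ι∈multiples-of-3 (n ∸ toℕ x) (begin
      (n ∸ toℕ x) % 3                  ≡⟨ cong₂ (λ a b → (a ∸ b) % 3) n≡k*3 x≡q*3 ⟩
      (k * 3 ∸ q * 3) % 3              ≡⟨ cong (_% 3) (*-distribʳ-∸ 3 k q) ⟨
      ((k ∸ q) * 3) % 3                ≡⟨ m*n%n≡0 (k ∸ q) 3 ⟩
      0                                ∎)
      where
      open ≡-Reasoning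
      q = toℕ x / 3
      k = _∣_.quotient 3∣n
      n≡k*3 : n ≡ k * 3
      n≡k*3 = _∣_.equality 3∣n
      x≡q*3 : toℕ x ≡ q * 3
      x≡q*3 = trans (m≡m%n+[m/n]*n (toℕ x) 3) (cong (_+ q * 3) (∈multiples-of-3⇒ x x∈))

  %3≡0-* : ∀ u m → u % 3 ≡ 0 → (u * m) % 3 ≡ 0
  %3≡0-* u m u%3≡0 = trans (%-distribˡ-* u m 3) (cong (λ k → (k * (m % 3)) % 3) u%3≡0)

  module _ (r : Fin n) (w : ℕ) (unit : w * toℕ r ≈ 1)
           (T : Subset n) (c : ℕ) (σ : ℕ → Bool) (σ≗T : ∀ u → σ u ≡ member T (c + u * toℕ r)) where
    open Progressions.UnitDifference n r w unit

    multiplesOf3⇒coset : IsMultiplesOf3 σ → Σ (Fin n) λ g → ∀ x →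
      (x ∈ T → ∃ λ h → h ∈ multiples-of-3 × x ≡ _⊕_ n g h) × ((∃ λ h → h ∈ multiples-of-3 × x ≡ _⊕_ n g h) → x ∈ T)
    multiplesOf3⇒coset (σ⇒%3 , %3⇒σ) = ι c , λ x → ⊆coset x , coset⊆ x
      where
      ⊆coset : ∀ x → x ∈ T → ∃ λ h → h ∈ multiples-of-3 × x ≡ _⊕_ n (ι c) h
      ⊆coset x x∈T with coordinate-∈ T c x x∈T
      ... | u , _ , u∈ , x≡ = ι (u * toℕ r) , ι∈multiples-of-3 (u * toℕ r) (%3≡0-* u (toℕ r) (σ⇒%3 u (trans (σ≗T u) u∈))) ,
                             trans x≡ (ι-cong (≈-sym (≈-+ (ι-≈ c) (ι-≈ (u * toℕ r)))))
      coset⊆ : ∀ x → (∃ λ h → h ∈ multiples-of-3 × x ≡ _⊕_ n (ι c) h) → x ∈ T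
      coset⊆ x (h , h∈ , x≡) = subst (_∈ T) (sym x≡′) (member⇒∈ T (c + u * toℕ r) (trans (sym (σ≗T u)) (%3⇒σ u u%3≡0)))
        where
        u = (toℕ h * w) % n
        u%3≡0 : u % 3 ≡ 0
        u%3≡0 = trans (m∣n⇒o%n%m≡o%m 3 n (toℕ h * w) 3∣n) (%3≡0-* (toℕ h) w (∈multiples-of-3⇒ h h∈))
        c+ur≈c+h : c + u * toℕ r ≈ toℕ (ι c) + toℕ h
        c+ur≈c+h = ≈-+ (≈-sym (ι-≈ c)) (begin
          u * toℕ r                     ≈⟨ ≈-*ʳ (toℕ r) (≈-% (toℕ h * w)) ⟩
          toℕ h * w * toℕ r             ≡⟨ *-assoc (toℕ h) w (toℕ r) ⟩
          toℕ h * (w * toℕ r)           ≈⟨ ≈-*ˡ (toℕ h) unit ⟩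
          toℕ h * 1                     ≡⟨ *-identityʳ (toℕ h) ⟩
          toℕ h                         ∎)
          where open ≈-Reasoning
        x≡′ : x ≡ ι (c + u * toℕ r)
        x≡′ = trans x≡ (ι-cong (≈-sym c+ur≈c+h))

multiplesOf3⇒coset : ∀ n .{{_ : NonZero n}} → n ≡ 12 → ∀ (r : Fin n) w → Congruence._≈_ n (w * toℕ r) 1 →
  ∀ (T : Subset n) c σ → (∀ u → σ u ≡ Subsets.member n T (c + u * toℕ r)) →
  Shapes.IsMultiplesOf3 n σ → IsCosetOfSubgroupOfOrder n 4 T
multiplesOf3⇒coset .12 refl r w unit T c σ σ≗T σ-multiples =
  multiples-of-3 , multiples-of-3-subgroup , refl , MultiplesOf3.multiplesOf3⇒coset 12 (divides 4 refl) r w unit T c σ σ≗T σ-multiples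
  where open MultiplesOf3 12 (divides 4 refl)

module QuasiProgressionCoordinates (n : ℕ) .{{_ : NonZero n}} (S : Subset n) (r : Fin n)
  (0∈S : 0ₙ n ∈ S) (S-quasi : IsQuasiProgression n r S) (S-generates : Generates n S) where

  open Congruence n
  open Subsets n
  open Progressions n r

  private
    ¬S-AP  = proj₁ S-quasi
    P      = proj₁ (proj₂ S-quasi)
    P-AP   = proj₁ (proj₂ (proj₂ S-quasi))
    z      = proj₁ (proj₂ (proj₂ (proj₂ S-quasi)))
    z∈P    = proj₁ (proj₂ (proj₂ (proj₂ (proj₂ S-quasi))))
    S≡P-z  = proj₂ (proj₂ (proj₂ (proj₂ (proj₂ S-quasi))))
    a      = proj₁ P-AP
    ℓ      = proj₁ (proj₂ P-AP)
    P-injective = proj₁ (proj₂ (proj₂ P-AP))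
    P-enumerated = proj₂ (proj₂ (proj₂ P-AP))

  c : ℕ
  c = toℕ a

  ℓ≤n : ℓ ≤ n
  ℓ≤n = injective⇒length≤n a ℓ P-injective

  index : ∀ x → x ∈ P → ∃ λ i → i < ℓ × x ≡ ι (c + i * toℕ r)
  index x x∈P with proj₁ (P-enumerated x) x∈P
  ... | i , x≡ = toℕ i , toℕ<n i , trans x≡ (a⊕i·r≡ι a (toℕ i))

  J : ℕ
  J = proj₁ (index z z∈P)

  K : ℕ
  K = ℓ ∸ 1

  i₀ : ℕ
  i₀ = proj₁ (index (0ₙ n) (proj₁ (proj₁ (S≡P-z (0ₙ n)) 0∈S)))

  c+i₀r≈0 : c + i₀ * toℕ r ≈ 0
  c+i₀r≈0 = ≈-trans (≈-sym (≡ι⇒≈ (proj₂ (proj₂ (index (0ₙ n) (proj₁ (proj₁ (S≡P-z (0ₙ n)) 0∈S))))))) (ι-≈ 0)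

  -- 0 = c + i₀ r lies in S, so c ≈ − i₀ r and every element of S is a multiple of r.
  generated-multiple : ∀ {x} → Gen n S x → ∃ λ q → toℕ x ≈ q * toℕ r
  generated-multiple (gen-elem {x} x∈S) with index x (proj₁ (proj₁ (S≡P-z x) x∈S))
  ... | i , _ , x≡ = (n ∸ 1) * i₀ + i , (begin
    toℕ x                             ≈⟨ ≡ι⇒≈ x≡ ⟩
    c + i * toℕ r                     ≈⟨ ≈-+ (≈-negate c+i₀r≈0) (≈-refl {i * toℕ r}) ⟩
    (n ∸ 1) * (i₀ * toℕ r) + i * toℕ r ≡⟨ collect (n ∸ 1) i₀ i (toℕ r) ⟩
    ((n ∸ 1) * i₀ + i) * toℕ r        ∎)
    where
    open ≈-Reasoning
    collect : ∀ m i₀ i r → m * (i₀ * r) + i * r ≡ (m * i₀ + i) * r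
    collect = solve-∀
  generated-multiple gen-zero = 0 , ι-≈ 0
  generated-multiple (gen-add {x} {y} x-gen y-gen) with generated-multiple x-gen | generated-multiple y-gen
  ... | q , x≈qr | q′ , y≈q′r = q + q′ , (begin
    toℕ (ι (toℕ x + toℕ y))           ≈⟨ ι-≈ (toℕ x + toℕ y) ⟩
    toℕ x + toℕ y                     ≈⟨ ≈-+ x≈qr y≈q′r ⟩
    q * toℕ r + q′ * toℕ r            ≡⟨ *-distribʳ-+ (toℕ r) q q′ ⟨
    (q + q′) * toℕ r                  ∎)
    where open ≈-Reasoning
  generated-multiple (gen-neg {x} x-gen) with generated-multiple x-gen
  ... | q , x≈qr = (n ∸ 1) * q , (begin
    toℕ (ι (n ∸ toℕ x))               ≈⟨ ι-≈ (n ∸ toℕ x) ⟩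
    n ∸ toℕ x                         ≈⟨ ≈-negate (trans (cong (_% n) (m∸n+n≡m (<⇒≤ (toℕ<n x)))) (≈-n 0)) ⟩
    (n ∸ 1) * toℕ x                   ≈⟨ ≈-*ˡ (n ∸ 1) x≈qr ⟩
    (n ∸ 1) * (q * toℕ r)             ≡⟨ *-assoc (n ∸ 1) q (toℕ r) ⟨
    (n ∸ 1) * q * toℕ r               ∎)
    where open ≈-Reasoning

  w : ℕ
  w = proj₁ (generated-multiple (S-generates (ι 1)))

  r-unit : w * toℕ r ≈ 1
  r-unit = ≈-trans (≈-sym (proj₂ (generated-multiple (S-generates (ι 1))))) (ι-≈ 1)

  open Progressions.UnitDifference n r w r-unit

  z≡ : z ≡ ι (c + J * toℕ r)
  z≡ = proj₂ (proj₂ (index z z∈P))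

  J<ℓ : J < ℓ
  J<ℓ = proj₁ (proj₂ (index z z∈P))

  S-coordinate⇒ : ∀ u → u < n → member S (c + u * toℕ r) ≡ true → u < ℓ × u ≢ J
  S-coordinate⇒ u u<n u∈S with proj₁ (S≡P-z (ι (c + u * toℕ r))) (member⇒∈ S _ u∈S)
  ... | x∈P , x≢z with index _ x∈P
  ...   | i , i<ℓ , x≡ = subst (_< ℓ) (sym u≡i) i<ℓ , λ u≡J → x≢z (trans (cong (λ k → ι (c + k * toℕ r)) u≡J) (sym z≡))
    where
    u≡i : u ≡ i
    u≡i = coordinate-unique c (ι-injective x≡) u<n (≤-trans i<ℓ ℓ≤n)

  S-coordinate⇐ : ∀ u → u < ℓ → u ≢ J → member S (c + u * toℕ r) ≡ true
  S-coordinate⇐ u u<ℓ u≢J = ∈⇒member S _ (proj₂ (S≡P-z x) (x∈P , x≢z))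
    where
    x = ι (c + u * toℕ r)
    x∈P : x ∈ P
    x∈P = proj₂ (P-enumerated x) (fromℕ< u<ℓ ,
            trans (cong (λ k → ι (c + k * toℕ r)) (sym (toℕ-fromℕ< u<ℓ))) (sym (a⊕i·r≡ι a (toℕ (fromℕ< u<ℓ)))))
    x≢z : x ≢ z
    x≢z x≡z = u≢J (coordinate-unique c (ι-injective (trans x≡z z≡)) (≤-trans u<ℓ ℓ≤n) (≤-trans J<ℓ ℓ≤n))

  1+K≡ℓ : suc K ≡ ℓ
  1+K≡ℓ = suc-pred ℓ {{>-nonZero (≤-trans (s≤s z≤n) J<ℓ)}}

  K≤n : K ≤ n
  K≤n = ≤-trans (m∸n≤m ℓ 1) ℓ≤n

  count-S-coordinates : count n (λ u → member S (c + u * toℕ r)) ≡ K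
  count-S-coordinates = begin
    count n S′                                   ≡⟨ cong (λ m → count m S′) (m+[n∸m]≡n ℓ≤n) ⟨
    count (ℓ + (n ∸ ℓ)) S′                       ≡⟨ count-split ℓ (n ∸ ℓ) S′ ⟩
    count ℓ S′ + count (n ∸ ℓ) (λ u → S′ (ℓ + u)) ≡⟨ cong₂ _+_ below-ℓ (count-false (n ∸ ℓ) beyond-ℓ) ⟩
    K + 0                                        ≡⟨ +-identityʳ K ⟩
    K                                            ∎
    where
    open ≡-Reasoning
    S′ = λ u → member S (c + u * toℕ r)
    below-ℓ : count ℓ S′ ≡ K
    below-ℓ = suc-injective (begin
      suc (count ℓ S′)                               ≡⟨ cong suc (count-cong ℓ (λ u u<ℓ → ⇔⇒≡
                                                          (λ u∈ → not-false (dec-false (u ≟ J) (proj₂ (S-coordinate⇒ u (≤-trans u<ℓ ℓ≤n) u∈))))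
                                                          (λ u≢J → S-coordinate⇐ u u<ℓ (separates (λ k → not (does (k ≟ J))) u≢J (cong not (dec-true (J ≟ J) refl)))))) ⟩
      suc (count ℓ ((λ _ → true) except J))          ≡⟨ count-except ℓ J (λ _ → true) J<ℓ refl ⟩
      count ℓ (λ _ → true)                           ≡⟨ count-true ℓ ⟩
      ℓ                                              ≡⟨ 1+K≡ℓ ⟨
      suc K                                          ∎)
    beyond-ℓ : ∀ u → u < n ∸ ℓ → S′ (ℓ + u) ≡ false
    beyond-ℓ u u<n∸ℓ with S′ (ℓ + u) in ℓ+u∈
    ... | false = refl
    ... | true  = ⊥-elim (m+n≮m ℓ u (proj₁ (S-coordinate⇒ (ℓ + u) ℓ+u<n ℓ+u∈)))
      where
      ℓ+u<n : ℓ + u < n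
      ℓ+u<n = ≤-trans (+-monoʳ-< ℓ u<n∸ℓ) (≤-reflexive (m+[n∸m]≡n ℓ≤n))

  |S|≡K : ∣ S ∣ ≡ K
  |S|≡K = trans (∣X∣≡count-member S)
                (trans (sym (Periodicity.count-affine n (member S) (member-periodic S) c {toℕ r} {w} r-unit)) count-S-coordinates)

  -- Deleting an end point of P would leave an arithmetic progression.
  J≢0 : J ≢ 0
  J≢0 J≡0 = ¬S-AP (progression⇒IsAP S (c + toℕ r) K K≤n ⊆progression progression⊆)
    where
    ⊆progression : ∀ x → x ∈ S → ∃ λ i → i < K × x ≡ ι (c + toℕ r + i * toℕ r)
    ⊆progression x x∈S with coordinate-∈ S c x x∈S
    ... | u , u<n , u∈ , x≡ with S-coordinate⇒ u u<n u∈
    ...   | u<ℓ , u≢J with u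
    ...     | zero  = ⊥-elim (u≢J (sym J≡0))
    ...     | suc i = i , s≤s⁻¹ (subst (suc i <_) (sym 1+K≡ℓ) u<ℓ) , trans x≡ (cong ι (sym (+-assoc c (toℕ r) (i * toℕ r))))
    progression⊆ : ∀ i → i < K → ι (c + toℕ r + i * toℕ r) ∈ S
    progression⊆ i i<K = subst (_∈ S) (cong ι (sym (+-assoc c (toℕ r) (i * toℕ r))))
      (member⇒∈ S _ (S-coordinate⇐ (suc i) (subst (suc i <_) 1+K≡ℓ (s≤s i<K)) (λ 1+i≡J → 0≢1+n (trans (sym J≡0) (sym 1+i≡J)))))

  J≢K : J ≢ K
  J≢K J≡K = ¬S-AP (progression⇒IsAP S c K K≤n ⊆progression progression⊆)
    where
    ⊆progression : ∀ x → x ∈ S → ∃ λ i → i < K × x ≡ ι (c + i * toℕ r)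
    ⊆progression x x∈S with coordinate-∈ S c x x∈S
    ... | u , u<n , u∈ , x≡ with S-coordinate⇒ u u<n u∈
    ...   | u<ℓ , u≢J = u , ≤∧≢⇒< (s≤s⁻¹ (subst (u <_) (sym 1+K≡ℓ) u<ℓ)) (λ u≡K → u≢J (trans u≡K (sym J≡K))) , x≡
    progression⊆ : ∀ i → i < K → ι (c + i * toℕ r) ∈ S
    progression⊆ i i<K = member⇒∈ S _ (S-coordinate⇐ i (subst (i <_) 1+K≡ℓ (m<n⇒m<1+n i<K)) (λ i≡J → <⇒≢ i<K (trans i≡J J≡K)))

  1≤J : 1 ≤ J
  1≤J = n≢0⇒n>0 J≢0

  J<K : J < K
  J<K = ≤∧≢⇒< (s≤s⁻¹ (subst (J <_) (sym 1+K≡ℓ) J<ℓ)) J≢K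

  module InCoordinates (T : Subset n) where
    open Periodicity n using (count-affine; unit-cancel)

    ρ : ℕ → Bool
    ρ u = member T (u * toℕ r)

    ρ-periodic : Periodic n ρ
    ρ-periodic a≈b = member-periodic T (≈-*ʳ (toℕ r) a≈b)

    |T|≡count-ρ : ∣ T ∣ ≡ count n ρ
    |T|≡count-ρ = trans (∣X∣≡count-member T) (sym (count-affine (member T) (member-periodic T) 0 {toℕ r} {w} r-unit))

    open Sumset n K J ρ using (ρ+D)

    private
      1≤ℓ : 1 ≤ ℓ
      1≤ℓ = ≤-trans (s≤s z≤n) J<ℓ

    sumset⇐ : ∀ v → ρ v ∨ ρ+D v ≡ true → member (sumset n S T) (c + v * toℕ r) ≡ true
    sumset⇐ v v∈ with ∨-elim (ρ v) (ρ+D v) v∈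
    ... | inj₁ ρv = ∈⇒member (sumset n S T) _ (subst (_∈ sumset n S T) s+t≡
                      (Subsets.∈sumset⇐ n S T (member⇒∈ S _ (S-coordinate⇐ 0 1≤ℓ (J≢0 ∘ sym))) (member⇒∈ T _ ρv)))
      where
      s+t≡ : _⊕_ n (ι (c + 0 * toℕ r)) (ι (v * toℕ r)) ≡ ι (c + v * toℕ r)
      s+t≡ = ι-cong (≈-trans (≈-+ (ι-≈ _) (ι-≈ _)) (≈-reflexive (cong (_+ v * toℕ r) (+-identityʳ c))))
    ... | inj₂ ρ+Dv with anyBelow-elim K _ ρ+Dv
    ...   | e , e<K , d∈D∧ρv-d = ∈⇒member (sumset n S T) _ (subst (_∈ sumset n S T) s+t≡
                                  (Subsets.∈sumset⇐ n S T (member⇒∈ S _ (S-coordinate⇐ (suc e) (subst (suc e <_) 1+K≡ℓ (s≤s e<K)) d≢J))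
                                                          (member⇒∈ T _ (∧-conicalʳ _ _ d∈D∧ρv-d))))
      where
      d≢J : suc e ≢ J
      d≢J = separates (λ k → not (does (k ≟ J))) (∧-conicalˡ _ _ d∈D∧ρv-d) (cong not (dec-true (J ≟ J) refl))
      s+t≡ : _⊕_ n (ι (c + suc e * toℕ r)) (ι ((v + (n ∸ suc e)) * toℕ r)) ≡ ι (c + v * toℕ r)
      s+t≡ = ι-cong (begin
        toℕ (ι (c + suc e * toℕ r)) + toℕ (ι ((v + (n ∸ suc e)) * toℕ r))
          ≈⟨ ≈-+ (ι-≈ _) (ι-≈ _) ⟩
        c + suc e * toℕ r + (v + (n ∸ suc e)) * toℕ r
          ≡⟨ regroup c (suc e) v (n ∸ suc e) (toℕ r) ⟩
        c + v * toℕ r + (suc e + (n ∸ suc e)) * toℕ r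
          ≡⟨ cong (λ k → c + v * toℕ r + k * toℕ r) (m+[n∸m]≡n (≤-trans e<K K≤n)) ⟩
        c + v * toℕ r + n * toℕ r
          ≈⟨ ≈-trans (≈-reflexive (cong (c + v * toℕ r +_) (*-comm n (toℕ r)))) (≈-kn (c + v * toℕ r) (toℕ r)) ⟩
        c + v * toℕ r ∎)
        where
        open ≈-Reasoning
        regroup : ∀ c d v d′ r → c + d * r + (v + d′) * r ≡ c + v * r + (d + d′) * r
        regroup = solve-∀

    sumset⇒ : ∀ v → member (sumset n S T) (c + v * toℕ r) ≡ true → ρ v ∨ ρ+D v ≡ true
    sumset⇒ v v∈ with Subsets.∈sumset⇒ n S T _ (member⇒∈ (sumset n S T) _ v∈)
    ... | s , t , s∈S , t∈T , s+t≡ with coordinate-∈ S c s s∈S | coordinate-∈ T 0 t t∈T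
    ...   | i , i<n , i∈ , s≡ | u , _ , u∈ , t≡ = summand i (S-coordinate⇒ i i<n i∈) i+u≈v
      where
      i+u≈v : i + u ≈ v
      i+u≈v = unit-cancel {toℕ r} {w} r-unit (≈-cancelˡ c (begin
        c + (i + u) * toℕ r                  ≡⟨ regroup c i u (toℕ r) ⟩
        (c + i * toℕ r) + (0 + u * toℕ r)    ≈⟨ ≈-+ (≈-sym (≡ι⇒≈ s≡)) (≈-sym (≡ι⇒≈ t≡)) ⟩
        toℕ s + toℕ t                        ≈⟨ ι-≈ (toℕ s + toℕ t) ⟨
        toℕ (_⊕_ n s t)                      ≈⟨ ≡ι⇒≈ s+t≡ ⟩
        c + v * toℕ r                        ∎))
        where
        open ≈-Reasoning
        regroup : ∀ c i u r → c + (i + u) * r ≡ (c + i * r) + (0 + u * r)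
        regroup = solve-∀
      summand : ∀ i → i < ℓ × i ≢ J → i + u ≈ v → ρ v ∨ ρ+D v ≡ true
      summand zero    _           u≈v = cong (_∨ ρ+D v) (trans (ρ-periodic (≈-sym u≈v)) u∈)
      summand (suc e) (i<ℓ , i≢J) i+u≈v′ = ∨-introʳ (ρ v) (anyBelow-intro K _ e e<K
        (cong₂ _∧_ (not-false (dec-false (suc e ≟ J) i≢J)) (trans (ρ-periodic v-i≈u) u∈)))
        where
        e<K : e < K
        e<K = s≤s⁻¹ (subst (suc e <_) (sym 1+K≡ℓ) i<ℓ)
        v-i≈u : v + (n ∸ suc e) ≈ u
        v-i≈u = ≈-via (suc e) ([w+[n∸i]]+i≈w v (suc e) (≤-trans e<K K≤n)) (≈-trans (≈-reflexive (+-comm u (suc e))) i+u≈v′)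

    small-sumset : ∣ sumset n S T ∣ ≤ ∣ S ∣ + ∣ T ∣ → count n (λ v → ρ v ∨ ρ+D v) ≤ K + count n ρ
    small-sumset |S+T|≤ = begin
      count n (λ v → ρ v ∨ ρ+D v)                            ≡⟨ count-cong n (λ v _ → ⇔⇒≡ (sumset⇒ v) (sumset⇐ v)) ⟨
      count n (λ v → member (sumset n S T) (c + v * toℕ r))  ≡⟨ count-affine (member (sumset n S T)) (member-periodic (sumset n S T)) c {toℕ r} {w} r-unit ⟩
      count n (member (sumset n S T))                        ≡⟨ ∣X∣≡count-member (sumset n S T) ⟨
      ∣ sumset n S T ∣                                       ≤⟨ |S+T|≤ ⟩
      ∣ S ∣ + ∣ T ∣                                          ≡⟨ cong₂ _+_ |S|≡K |T|≡count-ρ ⟩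
      K + count n ρ                                          ∎
      where open ≤-Reasoning

lemma7p1 : (n : ℕ) .{{_ : NonZero n}} (S T : Subset n) (r : Fin n) →
    0ₙ n ∈ S → IsQuasiProgression n r S → Generates n S → 3 ≤ ∣ S ∣ →
    3 ≤ ∣ T ∣ → ∣ sumset n S T ∣ ≤ ∣ S ∣ + ∣ T ∣ → ∣ S ∣ + ∣ T ∣ ≤ n ∸ 4 →
    (IsQuasiProgression n r T ⊎ IsAP n r T)
    ⊎ (n ≡ 12 × IsCosetOfSubgroupOfOrder n 4 T)
lemma7p1 n S T r 0∈S S-quasi S-generates |S|≥3 |T|≥3 |S+T|≤ |S|+|T|≤n∸4 =
  back-to-T (Structure.structure n K J ρ ρ-periodic 1≤J J<K K≥3 |ρ|≥3 large (small-sumset |S+T|≤))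
  where
  open QuasiProgressionCoordinates n S r 0∈S S-quasi S-generates
  open InCoordinates T
  open Progressions.UnitDifference n r w r-unit
  open Shapes n
  open Subsets n
  K≥3 : 3 ≤ K
  K≥3 = subst (3 ≤_) |S|≡K |S|≥3
  |ρ|≥3 : 3 ≤ count n ρ
  |ρ|≥3 = subst (3 ≤_) |T|≡count-ρ |T|≥3
  large : K + count n ρ + 4 ≤ n
  large = 0<m≤o∸n⇒m+n≤o 4 (≤-trans (s≤s z≤n) (≤-trans K≥3 (m≤m+n K _)))
            (subst (_≤ n ∸ 4) (cong₂ _+_ |S|≡K |T|≡count-ρ) |S|+|T|≤n∸4)
  ρ[b+u]≡ : ∀ b u → ρ (b + u) ≡ member T (b * toℕ r + u * toℕ r)
  ρ[b+u]≡ b u = cong (member T) (*-distribʳ-+ (toℕ r) b u)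
  back-to-T : SomeTranslate (λ σ → IsInitialSegment σ ⊎ IsPuncturedSegment σ) ρ ⊎ (n ≡ 12 × SomeTranslate IsMultiplesOf3 ρ) →
              (IsQuasiProgression n r T ⊎ IsAP n r T) ⊎ (n ≡ 12 × IsCosetOfSubgroupOfOrder n 4 T)
  back-to-T (inj₁ (b , inj₁ segment))   = inj₁ (inj₂ (initialSegment⇒IsAP T (b * toℕ r) _ (ρ[b+u]≡ b) segment))
  back-to-T (inj₁ (b , inj₂ punctured)) = inj₁ (puncturedSegment⇒ T (b * toℕ r) _ (ρ[b+u]≡ b) punctured)
  back-to-T (inj₂ (n≡12 , b , thirds))  = inj₂ (n≡12 , multiplesOf3⇒coset n n≡12 r w r-unit T (b * toℕ r) _ (ρ[b+u]≡ b) thirds)
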